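{- The following algorithm for $\operatorname{AND}_{<}$ is correct: on input lists $A_0,\dots,A_{m-1}$ its successive calls to next return, each exactly once, precisely the intervals of $\operatorname{AND}_{<}(A_0,\dots,A_{m-1})$, and then $\text{null}$. Algorithm (returning $[\infty\..\infty]$ means returning $\text{null}$): keep current intervals $[\ell_k\..r_k]$, $0\le k<m$, and an index $i$; initially $[\ell_0\..r_0]\leftarrow$ first interval of $A_0$, $[\ell_k\..r_k]\leftarrow[-\infty\..-\infty]$ for $0<k<m$, $i\leftarrow1$. next: $[\ell'\..r']\leftarrow[\infty\..\infty]$; $b\leftarrow\infty$; repeat forever \{ repeat forever \{ if $r_{i-1}\ge b$ return $[\ell'\..r']$; if $i=m$ or $\ell_i>r_{i-1}$ exit this inner loop; do \{ if $r_i\ge b$ or $A_i$ is exhausted return $[\ell'\..r']$; $[\ell_i\..r_i]\leftarrow$ next$(A_i)$ \} while $\ell_i\le r_{i-1}$; $i\leftarrow i+1$ \}; $[\ell'\..r']\leftarrow[\ell_0\..r_{m-1}]$; $b\leftarrow\ell_{m-1}$; $i\leftarrow1$; if $A_0$ is exhausted return $[\ell'\..r']$; $[\ell_0\..r_0]\leftarrow$ next$(A_0)$ \}.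
   Context: Let $O$ be a finite totally ordered set accessed only via comparisons; $\pm\infty$ denote special elements strictly smaller/larger than every element of $O$. A subset $X\subseteq O$ is an interval if $x,y\in X$, $x<z<y$ imply $z\in X$; nonempty intervals are written $[\ell\..r]$. For intervals $I,J$, $I\ll J$ means $x<y$ for all $x\in I$, $y\in J$. The interval spanned by a family of intervals is the least interval containing them all. An antichain of intervals is a set of intervals pairwise incomparable under inclusion, listed in natural order (by left extreme, equivalently right extreme). The input consists of $m$ lists $A_0,\dots,A_{m-1}$, each a nonempty antichain of nonempty intervals, delivered in natural order via a next function returning $\text{null}$ once exhausted. $\operatorname{AND}_{<}(A_0,\dots,A_{m-1})$ is the set of inclusion-minimal intervals among those spanned by tuples $\langle I_0,\dots,I_{m-1}\rangle\in A_0\times\dots\times A_{m-1}$ satisfying $I_{i-1}\ll I_i$ for $0<i<m$. -}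

module Defs where

open import Level using (0ℓ)
open import Data.Nat using (ℕ; zero; suc; pred; _≡ᵇ_)
open import Data.Bool using (Bool; true; false; if_then_else_; not; _∨_)
open import Data.List using (List; []; _∷_)
open import Data.List.Membership.Propositional using (_∈_)
open import Data.List.Relation.Unary.AllPairs using (AllPairs)
open import Data.Product using (Σ; _×_; _,_; proj₁; proj₂)
open import Data.Sum using (_⊎_)
open import Data.Maybe using (Maybe; just; nothing)
open import Data.Fin using (Fin; inject₁) renaming (suc to fsuc)
open import Data.Vec using (Vec; lookup; []; _∷_)
open import Relation.Nullary using (¬_)
open import Relation.Binary using (Rel; IsStrictTotalOrder; tri<; tri≈; tri>)
open import Relation.Binary.PropositionalEquality using (_≡_)

data Ext (A : Set) : Set where
  -∞  : Ext A
  fin : A → Ext A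
  +∞  : Ext A

Finite : Set → Set
Finite A = Σ (List A) λ xs → ∀ x → x ∈ xs

module _ {A : Set} (_<_ : Rel A 0ℓ) where

  _≤_ : A → A → Set
  x ≤ y = (x < y) ⊎ (x ≡ y)

  Itv : Set
  Itv = A × A

  left right : Itv → A
  left  = proj₁
  right = proj₂

  _∈I_ : A → Itv → Set
  x ∈I I = (left I ≤ x) × (x ≤ right I)

  NonEmptyI : Itv → Set
  NonEmptyI I = left I ≤ right I

  _⊆I_ : Itv → Itv → Set
  I ⊆I J = ∀ x → x ∈I I → x ∈I J

  _≪_ : Itv → Itv → Set
  I ≪ J = ∀ x y → x ∈I I → y ∈I J → x < y

  NaturalAntichain : List Itv → Set
  NaturalAntichain [] = Data.Empty.⊥
    where import Data.Empty
  NaturalAntichain (I ∷ Is) =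
    (∀ J → J ∈ (I ∷ Is) → NonEmptyI J) ×
    AllPairs (λ J K → (left J < left K) × (¬ (J ⊆I K)) × (¬ (K ⊆I J))) (I ∷ Is)

  module _ {n : ℕ} where
    -- a tuple ⟨I_0,…,I_{m-1}⟩ ∈ A_0 × … × A_{m-1} (m = suc n) with I_{i-1} ≪ I_i
    Tuple : Vec (List Itv) (suc n) → (Fin (suc n) → Itv) → Set
    Tuple As Is = (∀ k → Is k ∈ lookup As k) × (∀ (k : Fin n) → Is (inject₁ k) ≪ Is (fsuc k))

    Spans : Itv → (Fin (suc n) → Itv) → Set
    Spans J Is = (∀ k → Is k ⊆I J) × (∀ K → (∀ k → Is k ⊆I K) → J ⊆I K)

    SpannedByTuple : Vec (List Itv) (suc n) → Itv → Set
    SpannedByTuple As J = Σ (Fin (suc n) → Itv) λ Is → Tuple As Is × Spans J Is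

    InAND : Vec (List Itv) (suc n) → Itv → Set
    InAND As J = SpannedByTuple As J ×
                 (∀ J' → SpannedByTuple As J' → J' ⊆I J → J ⊆I J')

-- The algorithm, with explicit fuel to make it a total function.
module _ {A : Set} (_<_ : Rel A 0ℓ) (sto : IsStrictTotalOrder _≡_ _<_) where
  open IsStrictTotalOrder sto using (compare)

  ltA : A → A → Bool
  ltA a b with compare a b
  ... | tri< _ _ _ = true
  ... | tri≈ _ _ _ = false
  ... | tri> _ _ _ = false

  ltE : Ext A → Ext A → Bool
  ltE -∞ -∞ = false
  ltE -∞ (fin _) = true
  ltE -∞ +∞ = true
  ltE (fin _) -∞ = false
  ltE (fin a) (fin b) = ltA a b
  ltE (fin _) +∞ = true
  ltE +∞ _ = false

  leE : Ext A → Ext A → Bool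
  leE x y = not (ltE y x)

  EItv : Set
  EItv = Ext A × Ext A

  emb : Itv _<_ → EItv
  emb (l , r) = (fin l , fin r)

  nullI : EItv
  nullI = (+∞ , +∞)

  lo hi : EItv → Ext A
  lo = proj₁
  hi = proj₂

  upd : {B : Set} → (ℕ → B) → ℕ → B → ℕ → B
  upd f k v j = if j ≡ᵇ k then v else f j

  -- state persisting between calls: current intervals, unread parts of the
  -- input lists, and the index i
  record St : Set where
    constructor st
    field
      cur : ℕ → EItv
      rem : ℕ → List (Itv _<_)
      idx : ℕ
  open St

  data Res : Set where
    ret  : St → Res
    exit : St → Res

  advance : St → ℕ → Itv _<_ → List (Itv _<_) → St
  advance s k J Js = record s { cur = upd (cur s) k (emb J) ; rem = upd (rem s) k Js }

  mutual
    -- inner "repeat forever" loop; M = m, b = bound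
    inner : ℕ → ℕ → Ext A → St → Maybe Res
    inner zero _ _ _ = nothing
    inner (suc f) M b s =
      if leE b (hi (cur s (pred (idx s)))) then just (ret s)
      else if (idx s ≡ᵇ M) ∨ ltE (hi (cur s (pred (idx s)))) (lo (cur s (idx s)))
           then just (exit s)
      else doLoop f M b s

    -- the do { … } while ℓ_i ≤ r_{i-1} loop
    doLoop : ℕ → ℕ → Ext A → St → Maybe Res
    doLoop zero _ _ _ = nothing
    doLoop (suc f) M b s =
      if leE b (hi (cur s (idx s))) then just (ret s)
      else doStep f M b s (rem s (idx s))

    doStep : ℕ → ℕ → Ext A → St → List (Itv _<_) → Maybe Res
    doStep f M b s [] = just (ret s)
    doStep f M b s (J ∷ Js) =
      let s' = advance s (idx s) J Js in
      if leE (lo (cur s' (idx s'))) (hi (cur s' (pred (idx s'))))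
      then doLoop f M b s'
      else inner f M b (record s' { idx = suc (idx s') })

  mutual
    -- outer "repeat forever" loop of next; out = [ℓ'..r'], b = bound
    outer : ℕ → ℕ → EItv → Ext A → St → Maybe (EItv × St)
    outer zero _ _ _ _ = nothing
    outer (suc f) M out b s = afterInner f M out (inner f M b s)

    afterInner : ℕ → ℕ → EItv → Maybe Res → Maybe (EItv × St)
    afterInner f M out nothing = nothing
    afterInner f M out (just (ret s)) = just (out , s)
    afterInner f M out (just (exit s)) =
      outerTail f M (lo (cur s 0) , hi (cur s (pred M))) (lo (cur s (pred M)))
                (record s { idx = 1 }) (rem s 0)

    outerTail : ℕ → ℕ → EItv → Ext A → St → List (Itv _<_) → Maybe (EItv × St)
    -- A_0 exhausted: return [ℓ'..r']; the exhausted list A_0 now yields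
    -- null, i.e. [ℓ_0..r_0] = [∞..∞]
    outerTail f M out b s [] = just (out , record s { cur = upd (cur s) 0 nullI })
    outerTail f M out b s (J ∷ Js) = outer f M out b (advance s 0 J Js)

  -- one call of next (returns nullI = [∞..∞] for null), with given fuel
  nextCall : ℕ → ℕ → St → Maybe (EItv × St)
  nextCall f M s = outer f M nullI +∞ s

  calls : ℕ → ℕ → ℕ → St → Maybe (List EItv)
  calls f M zero s = just []
  calls f M (suc c) s with nextCall f M s
  ... | nothing = nothing
  ... | just (o , s') with calls f M c s'
  ...   | nothing = nothing
  ...   | just os = just (o ∷ os)

  ixList : {k : ℕ} → Vec (List (Itv _<_)) k → ℕ → List (Itv _<_)
  ixList [] _ = []
  ixList (x ∷ xs) zero = x
  ixList (x ∷ xs) (suc j) = ixList xs j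

  initSt : {n : ℕ} → Vec (List (Itv _<_)) (suc n) → St
  initSt (A0 ∷ As) = initFrom A0 (A0 ∷ As)
    where
      initFrom : {k : ℕ} → List (Itv _<_) → Vec (List (Itv _<_)) k → St
      initFrom [] v = st (λ _ → (-∞ , -∞)) (ixList v) 1
      initFrom (J ∷ Js) v =
        st (upd (λ _ → (-∞ , -∞)) 0 (emb J)) (upd (ixList v) 0 Js) 1

module Submission where

-- The algorithm keeps one cursor per list. Each cursor starts no later than the corresponding
-- interval of any chain whose first interval is at or after the current interval J0 of A_0, since
-- an interval is skipped only when it overlaps the cursor before it. So when the inner loop
-- completes a chain, its span [ℓ_0..r_{m-1}] is the only candidate for a minimal span with left
-- end ℓ_0. It is minimal iff no chain from a later first interval has its last interval starting
-- by b = ℓ_{m-1}: the next search either returns as soon as a cursor reaches b, which rules such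
-- chains out, or completes a chain ending in the same last interval, which replaces the candidate.
-- Every inner step reads an input interval, so fuel linear in the total input length suffices.

open import Defs hiding (_≤_; lo; hi)
open import Level using (0ℓ)
open import Data.Bool using (true; false; T; if_then_else_)
open import Data.Bool.Properties using (T-≡; ¬-not)
open import Data.Empty using (⊥; ⊥-elim)
open import Data.Unit using (⊤; tt)
open import Data.Fin using (Fin; inject₁; toℕ; fromℕ; fromℕ<) renaming (zero to fzero; suc to fsuc)
open import Data.Fin.Properties using (toℕ-injective; toℕ<n; toℕ-inject₁; toℕ-fromℕ; toℕ-fromℕ<)
open import Data.List using (List; []; _∷_; length; map; _++_)
open import Data.List.Membership.Propositional using (_∈_)
open import Data.List.Relation.Unary.Any using (here; there)
open import Data.List.Relation.Unary.All as All using (All)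
open import Data.List.Relation.Unary.AllPairs as AllPairs using (AllPairs; []; _∷_)
open import Data.List.Relation.Unary.Unique.Propositional using (Unique)
open import Data.Nat as ℕ using (ℕ; zero; suc; z≤n; s≤s; _≡ᵇ_; _+_; _*_)
import Data.Nat.Properties as ℕₚ
open import Data.Nat.Properties using (≡ᵇ⇒≡; ≡⇒≡ᵇ)
open import Data.Maybe using (Maybe; just)
open import Data.Product using (Σ; _×_; _,_; proj₁; proj₂)
open import Data.Vec using (Vec; lookup; []; _∷_)
open import Data.Sum using (_⊎_; inj₁; inj₂)
open import Function using (_∘_; Equivalence)
open import Relation.Nullary using (¬_; yes; no)
open import Relation.Binary using (Rel; IsStrictTotalOrder; Transitive; Irreflexive; tri<; tri≈; tri>)
open import Relation.Binary.PropositionalEquality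
  using (_≡_; _≢_; refl; sym; trans; cong; cong₂; subst; subst₂; isEquivalence; module ≡-Reasoning)
import Relation.Binary.Construct.StrictToNonStrict as StrictToNonStrict

≡ᵇ≡true⇒≡ : ∀ j k → (j ≡ᵇ k) ≡ true → j ≡ k
≡ᵇ≡true⇒≡ j k e = ≡ᵇ⇒≡ j k (subst T (sym e) _)

≡ᵇ≡false⇒≢ : ∀ j k → (j ≡ᵇ k) ≡ false → j ≢ k
≡ᵇ≡false⇒≢ j .j e refl = subst T e (≡⇒≡ᵇ j j refl)

≡ᵇ-refl : ∀ k → (k ≡ᵇ k) ≡ true
≡ᵇ-refl k = Equivalence.to T-≡ (≡⇒≡ᵇ k k refl)

≢⇒≡ᵇ≡false : ∀ {j k} → j ≢ k → (j ≡ᵇ k) ≡ false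
≢⇒≡ᵇ≡false j≢k = ¬-not (j≢k ∘ ≡ᵇ≡true⇒≡ _ _)

allPairs-cases : ∀ {X : Set} {R : X → X → Set} {xs : List X} → AllPairs R xs →
                 ∀ {x y} → x ∈ xs → y ∈ xs → (x ≡ y) ⊎ (R x y ⊎ R y x)
allPairs-cases (_ ∷ _) (here refl) (here refl) = inj₁ refl
allPairs-cases (Rx ∷ _) (here refl) (there q) = inj₂ (inj₁ (All.lookup Rx q))
allPairs-cases (Rx ∷ _) (there p) (here refl) = inj₂ (inj₂ (All.lookup Rx p))
allPairs-cases (_ ∷ Rxs) (there p) (there q) = allPairs-cases Rxs p q

clamp : ∀ m → ℕ → Fin (suc m)
clamp zero _ = fzero
clamp (suc m) zero = fzero
clamp (suc m) (suc k) = fsuc (clamp m k)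

toℕ-clamp : ∀ m k → k ℕ.≤ m → toℕ (clamp m k) ≡ k
toℕ-clamp zero zero _ = refl
toℕ-clamp (suc m) zero _ = refl
toℕ-clamp (suc m) (suc k) (s≤s k≤m) = cong suc (toℕ-clamp m k k≤m)

clamp-toℕ : ∀ m (f : Fin (suc m)) → clamp m (toℕ f) ≡ f
clamp-toℕ zero fzero = refl
clamp-toℕ (suc m) fzero = refl
clamp-toℕ (suc m) (fsuc f) = cong fsuc (clamp-toℕ m f)

module NonStrictProperties {X : Set} {_≺_ : Rel X 0ℓ}
                           (≺-trans : Transitive _≺_) (≺-irrefl : Irreflexive _≡_ _≺_) where
  open StrictToNonStrict _≡_ _≺_ public using (_≤_)

  ≤-refl : ∀ {x} → x ≤ x
  ≤-refl = inj₂ refl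

  ≤-trans : Transitive _≤_
  ≤-trans = StrictToNonStrict.trans _≡_ _≺_ isEquivalence
              ((λ {x} → subst (x ≺_)) , (λ {y} → subst (_≺ y))) ≺-trans

  <-≤-trans : ∀ {x y z} → x ≺ y → y ≤ z → x ≺ z
  <-≤-trans = StrictToNonStrict.<-≤-trans _≡_ _≺_ ≺-trans (λ {x} → subst (x ≺_))

  ≤-<-trans : ∀ {x y z} → x ≤ y → y ≺ z → x ≺ z
  ≤-<-trans = StrictToNonStrict.≤-<-trans _≡_ _≺_ sym ≺-trans (λ {y} → subst (_≺ y))

  ≤-antisym : ∀ {x y} → x ≤ y → y ≤ x → x ≡ y
  ≤-antisym = StrictToNonStrict.antisym _≡_ _≺_ isEquivalence ≺-trans ≺-irrefl

  <-irrefl : ∀ {x} → ¬ (x ≺ x)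
  <-irrefl = ≺-irrefl refl

  <⇒≱ : ∀ {x y} → x ≺ y → ¬ (y ≤ x)
  <⇒≱ x≺y y≤x = <-irrefl (<-≤-trans x≺y y≤x)

module Intervals {A : Set} {_<_ : Rel A 0ℓ} (sto : IsStrictTotalOrder _≡_ _<_) where
  open IsStrictTotalOrder sto public using (compare; asym) renaming (trans to <-trans)
  open NonStrictProperties <-trans (IsStrictTotalOrder.irrefl sto) public

  <-or-≥ : ∀ x y → (x < y) ⊎ (y ≤ x)
  <-or-≥ x y with compare x y
  ... | tri< x<y _ _ = inj₁ x<y
  ... | tri≈ _ x≡y _ = inj₂ (inj₂ (sym x≡y))
  ... | tri> _ _ y<x = inj₂ (inj₁ y<x)

  lft rgt : Itv _<_ → A
  lft = proj₁
  rgt = proj₂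

  ⊆I-intro : ∀ {J J'} → lft J ≤ lft J' → rgt J' ≤ rgt J → _⊆I_ _<_ J' J
  ⊆I-intro ℓ≤ℓ' r'≤r x (ℓ'≤x , x≤r') = ≤-trans ℓ≤ℓ' ℓ'≤x , ≤-trans x≤r' r'≤r

  ⊆I-elim : ∀ {J J'} → NonEmptyI _<_ J' → _⊆I_ _<_ J' J → (lft J ≤ lft J') × (rgt J' ≤ rgt J)
  ⊆I-elim {J} {J'} ne J'⊆J = proj₁ (J'⊆J (lft J') (≤-refl , ne)) , proj₂ (J'⊆J (rgt J') (ne , ≤-refl))

  antichain-sorted : ∀ {Is} → NaturalAntichain _<_ Is → AllPairs (λ J K → lft J < lft K) Is
  antichain-sorted {_ ∷ _} (_ , incomparable) = AllPairs.map proj₁ incomparable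

  antichain-nonEmpty : ∀ {Is K} → NaturalAntichain _<_ Is → K ∈ Is → NonEmptyI _<_ K
  antichain-nonEmpty {_ ∷ _} (nonEmpty , _) = nonEmpty _

  antichain-rgt-< : ∀ {Is K K'} → NaturalAntichain _<_ Is → K ∈ Is → K' ∈ Is →
                    lft K < lft K' → rgt K < rgt K'
  antichain-rgt-< {_ ∷ _} {K} {K'} (_ , incomparable) K∈ K'∈ ℓ<ℓ' with allPairs-cases incomparable K∈ K'∈
  ... | inj₁ refl = ⊥-elim (<-irrefl ℓ<ℓ')
  ... | inj₂ (inj₂ (ℓ'<ℓ , _)) = ⊥-elim (asym ℓ<ℓ' ℓ'<ℓ)
  ... | inj₂ (inj₁ (_ , _ , K'⊈K)) with <-or-≥ (rgt K) (rgt K')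
  ...   | inj₁ r<r' = r<r'
  ...   | inj₂ r'≤r = ⊥-elim (K'⊈K (⊆I-intro (inj₁ ℓ<ℓ') r'≤r))

  antichain-rgt-≤ : ∀ {Is K K'} → NaturalAntichain _<_ Is → K ∈ Is → K' ∈ Is →
                    lft K ≤ lft K' → rgt K ≤ rgt K'
  antichain-rgt-≤ ac K∈ K'∈ (inj₁ ℓ<ℓ') = inj₁ (antichain-rgt-< ac K∈ K'∈ ℓ<ℓ')
  antichain-rgt-≤ {_ ∷ _} (_ , incomparable) K∈ K'∈ (inj₂ ℓ≡ℓ') with allPairs-cases incomparable K∈ K'∈
  ... | inj₁ refl = ≤-refl
  ... | inj₂ (inj₁ (ℓ<ℓ' , _)) = ⊥-elim (<-irrefl (subst (_< _) ℓ≡ℓ' ℓ<ℓ'))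
  ... | inj₂ (inj₂ (ℓ'<ℓ , _)) = ⊥-elim (<-irrefl (subst (_ <_) ℓ≡ℓ' ℓ'<ℓ))

  spans-cong : ∀ {m J} {Is Is' : Fin (suc m) → Itv _<_} → (∀ f → Is f ≡ Is' f) →
               Spans _<_ J Is → Spans _<_ J Is'
  spans-cong {J = J} Is≗Is' (contained , least) =
    (λ f → subst (λ K → _⊆I_ _<_ K J) (Is≗Is' f) (contained f)) ,
    (λ K ⊆K → least K (λ f → subst (λ L → _⊆I_ _<_ L K) (sym (Is≗Is' f)) (⊆K f)))

  spans-unique : ∀ {m J K} {Is : Fin (suc m) → Itv _<_} → NonEmptyI _<_ (Is fzero) →
                 Spans _<_ J Is → Spans _<_ K Is → J ≡ K
  spans-unique {J = J} {K} ne (containedJ , leastJ) (containedK , leastK) =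
    cong₂ _,_ (≤-antisym (proj₁ K⊆J) (proj₁ J⊆K)) (≤-antisym (proj₂ J⊆K) (proj₂ K⊆J))
    where
      nonEmpty : ∀ {L} → (∀ f → _⊆I_ _<_ _ L) → NonEmptyI _<_ L
      nonEmpty {L} contained = let (ℓ≤ , ≤r) = ⊆I-elim ne (contained fzero) in ≤-trans ℓ≤ (≤-trans ne ≤r)
      J⊆K = ⊆I-elim (nonEmpty containedJ) (leastJ K containedK)
      K⊆J = ⊆I-elim (nonEmpty containedK) (leastK J containedJ)

  lookup≡ixList : ∀ {m} (v : Vec (List (Itv _<_)) m) f → lookup v f ≡ ixList _<_ sto v (toℕ f)
  lookup≡ixList (_ ∷ _) fzero = refl
  lookup≡ixList (_ ∷ v) (fsuc f) = lookup≡ixList v f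

  data _<ᵉ_ : Ext A → Ext A → Set where
    -∞<fin : ∀ {a} → -∞ <ᵉ fin a
    -∞<+∞ : -∞ <ᵉ +∞
    fin<fin : ∀ {a b} → a < b → fin a <ᵉ fin b
    fin<+∞ : ∀ {a} → fin a <ᵉ +∞

  <ᵉ-trans : Transitive _<ᵉ_
  <ᵉ-trans -∞<fin (fin<fin _) = -∞<fin
  <ᵉ-trans -∞<fin fin<+∞ = -∞<+∞
  <ᵉ-trans (fin<fin p) (fin<fin q) = fin<fin (<-trans p q)
  <ᵉ-trans (fin<fin _) fin<+∞ = fin<+∞

  <ᵉ-irrefl : Irreflexive _≡_ _<ᵉ_
  <ᵉ-irrefl refl (fin<fin a<a) = <-irrefl a<a

  open NonStrictProperties <ᵉ-trans <ᵉ-irrefl public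
    using () renaming (_≤_ to _≤ᵉ_; ≤-trans to ≤ᵉ-trans; ≤-<-trans to ≤ᵉ-<ᵉ-trans; <⇒≱ to <ᵉ⇒≱ᵉ)

  fin-≤ : ∀ {a b} → a ≤ b → fin a ≤ᵉ fin b
  fin-≤ (inj₁ a<b) = inj₁ (fin<fin a<b)
  fin-≤ (inj₂ refl) = inj₂ refl

  fin-≤⁻ : ∀ {a b} → fin a ≤ᵉ fin b → a ≤ b
  fin-≤⁻ (inj₁ (fin<fin a<b)) = inj₁ a<b
  fin-≤⁻ (inj₂ refl) = inj₂ refl

  fin-<⁻ : ∀ {a b} → fin a <ᵉ fin b → a < b
  fin-<⁻ (fin<fin a<b) = a<b

  -∞-≤ : ∀ {x} → -∞ ≤ᵉ x
  -∞-≤ { -∞} = inj₂ refl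
  -∞-≤ {fin _} = inj₁ -∞<fin
  -∞-≤ {+∞} = inj₁ -∞<+∞

  ≤ᵉ-∞ : ∀ {x} → x ≤ᵉ -∞ → x ≡ -∞
  ≤ᵉ-∞ (inj₂ refl) = refl

  +∞-≤ᵉ : ∀ {x} → +∞ ≤ᵉ x → x ≡ +∞
  +∞-≤ᵉ (inj₂ refl) = refl

  ltA≡true⇒< : ∀ {a b} → ltA _<_ sto a b ≡ true → a < b
  ltA≡true⇒< {a} {b} e with compare a b
  ... | tri< a<b _ _ = a<b
  ltA≡true⇒< () | tri≈ _ _ _
  ltA≡true⇒< () | tri> _ _ _

  ltA≡false⇒≥ : ∀ {a b} → ltA _<_ sto a b ≡ false → b ≤ a
  ltA≡false⇒≥ {a} {b} e with compare a b
  ltA≡false⇒≥ () | tri< _ _ _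
  ... | tri≈ _ a≡b _ = inj₂ (sym a≡b)
  ... | tri> _ _ b<a = inj₁ b<a

  ltE≡true⇒<ᵉ : ∀ x y → ltE _<_ sto x y ≡ true → x <ᵉ y
  ltE≡true⇒<ᵉ -∞ (fin _) _ = -∞<fin
  ltE≡true⇒<ᵉ -∞ +∞ _ = -∞<+∞
  ltE≡true⇒<ᵉ (fin _) (fin _) e = fin<fin (ltA≡true⇒< e)
  ltE≡true⇒<ᵉ (fin _) +∞ _ = fin<+∞
  ltE≡true⇒<ᵉ -∞ -∞ ()
  ltE≡true⇒<ᵉ (fin _) -∞ ()
  ltE≡true⇒<ᵉ +∞ _ ()

  ltE≡false⇒≥ᵉ : ∀ x y → ltE _<_ sto x y ≡ false → y ≤ᵉ x
  ltE≡false⇒≥ᵉ -∞ -∞ _ = inj₂ refl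
  ltE≡false⇒≥ᵉ (fin _) -∞ _ = inj₁ -∞<fin
  ltE≡false⇒≥ᵉ (fin _) (fin _) e = fin-≤ (ltA≡false⇒≥ e)
  ltE≡false⇒≥ᵉ +∞ -∞ _ = inj₁ -∞<+∞
  ltE≡false⇒≥ᵉ +∞ (fin _) _ = inj₁ fin<+∞
  ltE≡false⇒≥ᵉ +∞ +∞ _ = inj₂ refl
  ltE≡false⇒≥ᵉ -∞ (fin _) ()
  ltE≡false⇒≥ᵉ -∞ +∞ ()
  ltE≡false⇒≥ᵉ (fin _) +∞ ()

  leE≡true⇒≤ᵉ : ∀ x y → leE _<_ sto x y ≡ true → x ≤ᵉ y
  leE≡true⇒≤ᵉ x y e with ltE _<_ sto y x in y≮x
  leE≡true⇒≤ᵉ x y () | true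
  ... | false = ltE≡false⇒≥ᵉ y x y≮x

  leE≡false⇒>ᵉ : ∀ x y → leE _<_ sto x y ≡ false → y <ᵉ x
  leE≡false⇒>ᵉ x y e with ltE _<_ sto y x in y<x
  leE≡false⇒>ᵉ x y () | false
  ... | true = ltE≡true⇒<ᵉ y x y<x

module Updates {A : Set} {_<_ : Rel A 0ℓ} (sto : IsStrictTotalOrder _≡_ _<_) where
  open ≡-Reasoning

  upd-≡ : ∀ {B : Set} (f : ℕ → B) k v → upd _<_ sto f k v k ≡ v
  upd-≡ f k v = cong (λ b → if b then v else f k) (≡ᵇ-refl k)

  upd-≢ : ∀ {B : Set} (f : ℕ → B) {k} v {j} → j ≢ k → upd _<_ sto f k v j ≡ f j
  upd-≢ f v {j} j≢k = cong (λ b → if b then v else f j) (≢⇒≡ᵇ≡false j≢k)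

  lengthSum : {B : Set} → ℕ → (ℕ → List B) → ℕ
  lengthSum zero r = 0
  lengthSum (suc m) r = length (r m) + lengthSum m r

  lengthSum-upd-≥ : ∀ {B : Set} (r : ℕ → List B) k v m → m ℕ.≤ k → lengthSum m (upd _<_ sto r k v) ≡ lengthSum m r
  lengthSum-upd-≥ r k v zero _ = refl
  lengthSum-upd-≥ r k v (suc m) m<k =
    cong₂ _+_ (cong length (upd-≢ r v (ℕₚ.<⇒≢ m<k))) (lengthSum-upd-≥ r k v m (ℕₚ.<⇒≤ m<k))

  lengthSum-upd-tail : ∀ {B : Set} (r : ℕ → List B) k x xs m → k ℕ.< m → r k ≡ x ∷ xs →
                       lengthSum m r ≡ suc (lengthSum m (upd _<_ sto r k xs))
  lengthSum-upd-tail r k x xs (suc m) (s≤s k≤m) rk≡ with ℕₚ.m≤n⇒m<n∨m≡n k≤m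
  ... | inj₁ k<m = begin
    length (r m) + lengthSum m r
      ≡⟨ cong (length (r m) +_) (lengthSum-upd-tail r k x xs m k<m rk≡) ⟩
    length (r m) + suc (lengthSum m r')
      ≡⟨ ℕₚ.+-suc (length (r m)) _ ⟩
    suc (length (r m) + lengthSum m r')
      ≡⟨ cong (λ ys → suc (length ys + lengthSum m r')) (sym (upd-≢ r xs (ℕₚ.>⇒≢ k<m))) ⟩
    suc (length (r' m) + lengthSum m r') ∎
    where r' = upd _<_ sto r k xs
  ... | inj₂ refl = begin
    length (r k) + lengthSum k r
      ≡⟨ cong (λ ys → length ys + lengthSum k r) rk≡ ⟩
    suc (length xs + lengthSum k r)
      ≡⟨ cong suc (cong₂ _+_ (cong length (sym (upd-≡ r k xs))) (sym (lengthSum-upd-≥ r k xs k ℕₚ.≤-refl))) ⟩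
    suc (length (r' k) + lengthSum k r') ∎
    where r' = upd _<_ sto r k xs

module Correctness {A : Set} (_<_ : Rel A 0ℓ) (sto : IsStrictTotalOrder _≡_ _<_)
                   (n : ℕ) (As : Vec (List (Itv _<_)) (suc n))
                   (As-antichains : ∀ k → NaturalAntichain _<_ (lookup As k)) where
  open Intervals sto
  open Updates sto

  Iv : Set
  Iv = Itv _<_

  list : ℕ → List Iv
  list = ixList _<_ sto As

  list-antichain : ∀ {k} → k ℕ.≤ n → NaturalAntichain _<_ (list k)
  list-antichain {k} k≤n = subst (NaturalAntichain _<_)
    (trans (lookup≡ixList As (clamp n k)) (cong list (toℕ-clamp n k k≤n))) (As-antichains (clamp n k))

  Chain : (ℕ → Iv) → Set
  Chain T = (∀ k → k ℕ.≤ n → T k ∈ list k) × (∀ k → k ℕ.< n → rgt (T k) < lft (T (suc k)))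

  module _ {T : ℕ → Iv} (chain : Chain T) where

    chain-nonEmpty : ∀ {k} → k ℕ.≤ n → lft (T k) ≤ rgt (T k)
    chain-nonEmpty k≤n = antichain-nonEmpty (list-antichain k≤n) (proj₁ chain _ k≤n)

    chain-< : ∀ {k k'} → k ℕ.< k' → k' ℕ.≤ n → rgt (T k) < lft (T k')
    chain-< {k} {suc k'} (s≤s k≤k') k'<n with ℕₚ.m≤n⇒m<n∨m≡n k≤k'
    ... | inj₂ refl = proj₂ chain k k'<n
    ... | inj₁ k<k' = <-≤-trans (chain-< k<k' (ℕₚ.<⇒≤ k'<n))
                        (≤-trans (chain-nonEmpty (ℕₚ.<⇒≤ k'<n)) (inj₁ (proj₂ chain k' k'<n)))

    chain-≤ : ∀ {k k'} → k ℕ.≤ k' → k' ℕ.≤ n → (lft (T k) ≤ lft (T k')) × (rgt (T k) ≤ rgt (T k'))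
    chain-≤ k≤k' k'≤n with ℕₚ.m≤n⇒m<n∨m≡n k≤k'
    ... | inj₂ refl = ≤-refl , ≤-refl
    ... | inj₁ k<k' = ≤-trans (chain-nonEmpty (ℕₚ.≤-trans k≤k' k'≤n)) (inj₁ (chain-< k<k' k'≤n)) ,
                      inj₁ (<-≤-trans (chain-< k<k' k'≤n) (chain-nonEmpty k'≤n))

  ChainSpan : Iv → Set
  ChainSpan J = Σ (ℕ → Iv) λ T → Chain T × (J ≡ (lft (T 0) , rgt (T n)))

  _⊑_ : Iv → Iv → Set
  J' ⊑ J = (lft J ≤ lft J') × (rgt J' ≤ rgt J)

  MinimalSpan : Iv → Set
  MinimalSpan J = ChainSpan J × (∀ J' → ChainSpan J' → J' ⊑ J → J ⊑ J')

  chainSpan-nonEmpty : ∀ {J} → ChainSpan J → lft J ≤ rgt J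
  chainSpan-nonEmpty (T , chain , refl) = ≤-trans (chain-nonEmpty chain z≤n) (proj₂ (chain-≤ chain z≤n ℕₚ.≤-refl))

  minimalSpan-unique : ∀ {J J'} → MinimalSpan J → MinimalSpan J' → lft J ≡ lft J' → J ≡ J'
  minimalSpan-unique {J} {J'} (span , minimal) (span' , minimal') ℓ≡ℓ' with <-or-≥ (rgt J) (rgt J')
  ... | inj₁ r<r' = ⊥-elim (<⇒≱ r<r' (proj₂ (minimal' J span (inj₂ (sym ℓ≡ℓ') , inj₁ r<r'))))
  ... | inj₂ r'≤r = cong₂ _,_ ℓ≡ℓ' (≤-antisym (proj₂ (minimal J' span' (inj₂ ℓ≡ℓ' , r'≤r))) r'≤r)

  private
    toℕ≤n : ∀ (f : Fin (suc n)) → toℕ f ℕ.≤ n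
    toℕ≤n f = ℕₚ.≤-pred (toℕ<n f)

  chain⇒tuple : ∀ {T} → Chain T → Tuple _<_ As (T ∘ toℕ)
  chain⇒tuple {T} (T∈ , T<) = member , separated
    where
      member : ∀ f → T (toℕ f) ∈ lookup As f
      member f = subst (T (toℕ f) ∈_) (sym (lookup≡ixList As f)) (T∈ (toℕ f) (toℕ≤n f))
      separated : ∀ (f : Fin n) → _≪_ _<_ (T (toℕ (inject₁ f))) (T (toℕ (fsuc f)))
      separated f x y (_ , x≤r) (ℓ≤y , _) =
        ≤-<-trans (subst (λ k → x ≤ rgt (T k)) (toℕ-inject₁ f) x≤r) (<-≤-trans (T< (toℕ f) (toℕ<n f)) ℓ≤y)

  chain-spans : ∀ {T} → Chain T → Spans _<_ (lft (T 0) , rgt (T n)) (T ∘ toℕ)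
  chain-spans {T} chain = contained , least
    where
      contained : ∀ f → _⊆I_ _<_ (T (toℕ f)) (lft (T 0) , rgt (T n))
      contained f = ⊆I-intro (proj₁ (chain-≤ chain z≤n (toℕ≤n f)))
                             (proj₂ (chain-≤ chain (toℕ≤n f) ℕₚ.≤-refl))
      least : ∀ K → (∀ f → _⊆I_ _<_ (T (toℕ f)) K) → _⊆I_ _<_ (lft (T 0) , rgt (T n)) K
      least K ⊆K = ⊆I-intro (proj₁ (⊆I-elim (chain-nonEmpty chain z≤n) (⊆K fzero)))
                            (subst (λ k → rgt (T k) ≤ rgt K) (toℕ-fromℕ n)
                              (proj₂ (⊆I-elim (chain-nonEmpty chain (toℕ≤n (fromℕ n))) (⊆K (fromℕ n)))))

  tuple⇒chain : ∀ {Is} → Tuple _<_ As Is → Chain (Is ∘ clamp n)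
  tuple⇒chain {Is} (Is∈ , Is≪) = T∈ , T<
    where
      T∈ : ∀ k → k ℕ.≤ n → Is (clamp n k) ∈ list k
      T∈ k k≤n = subst (Is (clamp n k) ∈_)
                   (trans (lookup≡ixList As (clamp n k)) (cong list (toℕ-clamp n k k≤n))) (Is∈ (clamp n k))
      T< : ∀ k → k ℕ.< n → rgt (Is (clamp n k)) < lft (Is (clamp n (suc k)))
      T< k k<n = subst₂ (λ g h → rgt (Is g) < lft (Is h)) inject≡ suc≡
                   (Is≪ f _ _ (subst (λ g → rgt (Is g) ∈I' Is g) (sym inject≡) (nonEmpty k (ℕₚ.<⇒≤ k<n) , ≤-refl))
                              (≤-refl , subst (λ g → NonEmptyI _<_ (Is g)) (sym suc≡) (nonEmpty (suc k) k<n)))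
        where
          _∈I'_ : A → Iv → Set
          x ∈I' K = _∈I_ _<_ x K
          nonEmpty : ∀ j → j ℕ.≤ n → NonEmptyI _<_ (Is (clamp n j))
          nonEmpty j j≤n = antichain-nonEmpty (list-antichain j≤n) (T∈ j j≤n)
          f : Fin n
          f = fromℕ< k<n
          inject≡ : inject₁ f ≡ clamp n k
          inject≡ = toℕ-injective (trans (toℕ-inject₁ f)
                                    (trans (toℕ-fromℕ< k<n) (sym (toℕ-clamp n k (ℕₚ.<⇒≤ k<n)))))
          suc≡ : fsuc f ≡ clamp n (suc k)
          suc≡ = toℕ-injective (trans (cong suc (toℕ-fromℕ< k<n)) (sym (toℕ-clamp n (suc k) k<n)))

  chainSpan⇒spannedByTuple : ∀ {J} → ChainSpan J → SpannedByTuple _<_ As J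
  chainSpan⇒spannedByTuple (T , chain , refl) = T ∘ toℕ , chain⇒tuple chain , chain-spans chain

  spannedByTuple⇒chainSpan : ∀ {J} → SpannedByTuple _<_ As J → ChainSpan J
  spannedByTuple⇒chainSpan (Is , tuple , spans) =
    Is ∘ clamp n , chain ,
    spans-unique (antichain-nonEmpty (As-antichains fzero) (proj₁ tuple fzero)) spans
                 (spans-cong (cong Is ∘ clamp-toℕ n) (chain-spans chain))
    where chain = tuple⇒chain tuple

  inAND⇒minimalSpan : ∀ {J} → InAND _<_ As J → MinimalSpan J
  inAND⇒minimalSpan (spanned , minimal) = span , λ J' span' (ℓ≤ℓ' , r'≤r) →
    ⊆I-elim (chainSpan-nonEmpty span) (minimal J' (chainSpan⇒spannedByTuple span') (⊆I-intro ℓ≤ℓ' r'≤r))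
    where span = spannedByTuple⇒chainSpan spanned

  minimalSpan⇒inAND : ∀ {J} → MinimalSpan J → InAND _<_ As J
  minimalSpan⇒inAND (span , minimal) = chainSpan⇒spannedByTuple span , λ J' spanned' J'⊆J →
    let span' = spannedByTuple⇒chainSpan spanned'
        (ℓ'≤ℓ , r≤r') = minimal J' span' (⊆I-elim (chainSpan-nonEmpty span') J'⊆J)
    in ⊆I-intro ℓ'≤ℓ r≤r'

  EI : Set
  EI = EItv _<_ sto

  lo hi : EI → Ext A
  lo = proj₁
  hi = proj₂

  finItv : Iv → EI
  finItv J = fin (lft J) , fin (rgt J)

  finItv-injective : ∀ {J J'} → finItv J ≡ finItv J' → J ≡ J'
  finItv-injective refl = refl

  lo-finItv : ∀ {e J} → e ≡ finItv J → lo e ≡ fin (lft J)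
  lo-finItv refl = refl

  hi-finItv : ∀ {e J} → e ≡ finItv J → hi e ≡ fin (rgt J)
  hi-finItv refl = refl

  unsetItv : EI
  unsetItv = -∞ , -∞

  totalUnread : (ℕ → List Iv) → ℕ
  totalUnread = lengthSum (suc n)

  StartsBefore : Iv → Iv → Set
  StartsBefore J K = lft J < lft K

  -- J is the current interval of list k and rest is what next(A_k) has not yet returned
  record Cursor (k : ℕ) (J : Iv) (rest : List Iv) : Set where
    field
      current∈ : J ∈ list k
      rest⊆ : ∀ {K} → K ∈ rest → K ∈ list k
      rest-sorted : AllPairs StartsBefore rest
      rest-after : All (StartsBefore J) rest
      read-≤ : ∀ {K} → K ∈ list k → (K ∈ rest) ⊎ (lft K ≤ lft J)

  CursorAt : ℕ → EI → List Iv → Set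
  CursorAt k e rest = ((e ≡ unsetItv) × (rest ≡ list k)) ⊎ (Σ Iv λ J → (e ≡ finItv J) × Cursor k J rest)

  cursor-start : ∀ {k J Js} → k ℕ.≤ n → list k ≡ J ∷ Js → Cursor k J Js
  cursor-start {k} {J} {Js} k≤n list≡ = record
    { current∈ = subst (_ ∈_) (sym list≡) (here refl)
    ; rest⊆ = λ K∈ → subst (_ ∈_) (sym list≡) (there K∈)
    ; rest-sorted = AllPairs.tail sorted
    ; rest-after = AllPairs.head sorted
    ; read-≤ = λ K∈ → read (subst (_ ∈_) list≡ K∈)
    }
    where
      sorted = subst (AllPairs StartsBefore) list≡ (antichain-sorted (list-antichain k≤n))
      read : ∀ {K} → K ∈ J ∷ Js → (K ∈ Js) ⊎ (lft K ≤ lft J)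
      read (here refl) = inj₂ ≤-refl
      read (there K∈) = inj₁ K∈

  module CursorStep {k Jo J Js} (cursor : Cursor k Jo (J ∷ Js)) where
    open Cursor cursor

    advances : lft Jo < lft J
    advances = All.head rest-after

    step : Cursor k J Js
    step = record
      { current∈ = rest⊆ (here refl)
      ; rest⊆ = rest⊆ ∘ there
      ; rest-sorted = AllPairs.tail rest-sorted
      ; rest-after = AllPairs.head rest-sorted
      ; read-≤ = read
      }
      where
        read : ∀ {K} → K ∈ list k → (K ∈ Js) ⊎ (lft K ≤ lft J)
        read K∈ with read-≤ K∈
        ... | inj₁ (here refl) = inj₂ ≤-refl
        ... | inj₁ (there K∈Js) = inj₁ K∈Js
        ... | inj₂ ℓ≤ℓo = inj₂ (inj₁ (≤-<-trans ℓ≤ℓo advances))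

    skipped-≤ : ∀ {K} → K ∈ list k → lft K < lft J → lft K ≤ lft Jo
    skipped-≤ K∈ ℓ<ℓJ with read-≤ K∈
    ... | inj₂ ℓ≤ℓo = ℓ≤ℓo
    ... | inj₁ (here refl) = ⊥-elim (<-irrefl ℓ<ℓJ)
    ... | inj₁ (there K∈Js) = ⊥-elim (asym ℓ<ℓJ (All.lookup (AllPairs.head rest-sorted) K∈Js))

    next-≤ : ∀ {K} → K ∈ list k → lft Jo < lft K → lft J ≤ lft K
    next-≤ K∈ ℓo<ℓ with read-≤ K∈
    ... | inj₂ ℓ≤ℓo = ⊥-elim (<⇒≱ ℓo<ℓ ℓ≤ℓo)
    ... | inj₁ (here refl) = ≤-refl
    ... | inj₁ (there K∈Js) = inj₁ (All.lookup (AllPairs.head rest-sorted) K∈Js)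

  SkippedBelow : ℕ → EI → Ext A → Set
  SkippedBelow k e h = ∀ J → e ≡ finItv J → ∀ K → K ∈ list k → lft K < lft J → fin (lft K) ≤ᵉ h

  _≪ᵉ_ : EI → EI → Set
  e ≪ᵉ e' = hi e <ᵉ lo e'

  Loaded : EI → Set
  Loaded e = Σ Iv λ J → e ≡ finItv J

  record Cursors (c : ℕ → EI) (r : ℕ → List Iv) (J0 : Iv) : Set where
    field
      first : c 0 ≡ finItv J0
      firstCursor : Cursor 0 J0 (r 0)
      cursorAt : ∀ k → k ℕ.< n → CursorAt (suc k) (c (suc k)) (r (suc k))
      skipped : ∀ k → k ℕ.< n → SkippedBelow (suc k) (c (suc k)) (hi (c k))

  module _ {c r J0} (cursors : Cursors c r J0) where
    open Cursors cursors

    unset-or-loaded : ∀ k → k ℕ.≤ n → (c k ≡ unsetItv) ⊎ Loaded (c k)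
    unset-or-loaded zero _ = inj₂ (J0 , first)
    unset-or-loaded (suc k) k<n with cursorAt k k<n
    ... | inj₁ (unset , _) = inj₁ unset
    ... | inj₂ (J , loaded , _) = inj₂ (J , loaded)

    loaded∈list : ∀ {k J} → k ℕ.≤ n → c k ≡ finItv J → J ∈ list k
    loaded∈list {zero} _ loaded = subst (_∈ list 0) (finItv-injective (trans (sym first) loaded))
                                        (Cursor.current∈ firstCursor)
    loaded∈list {suc k} k<n loaded with cursorAt k k<n
    ... | inj₁ (unset , _) with trans (sym unset) loaded
    ...   | ()
    loaded∈list {suc k} k<n loaded | inj₂ (J , loaded' , cursor) =
      subst (_∈ list (suc k)) (finItv-injective (trans (sym loaded') loaded)) (Cursor.current∈ cursor)

    separated⇒loaded : ∀ k → k ℕ.< n → c k ≪ᵉ c (suc k) → Loaded (c (suc k))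
    separated⇒loaded k k<n sep with cursorAt k k<n
    ... | inj₂ (J , loaded , _) = J , loaded
    ... | inj₁ (unset , _) with subst (λ e → hi (c k) <ᵉ lo e) unset sep
    ...   | ()

    -- An interval of list k+1 is skipped only if it starts at or before the right end of cursor k,
    -- so it cannot follow cursor k, nor (inductively) the k-th interval of a chain starting at or after J0.
    cursor-≤-chain : ∀ {T} → Chain T → lft J0 ≤ lft (T 0) →
                     ∀ k → k ℕ.≤ n → ∀ {J} → c k ≡ finItv J → lft J ≤ lft (T k)
    cursor-≤-chain chain J0≤ zero _ loaded = subst (λ J → lft J ≤ _) (finItv-injective (trans (sym first) loaded)) J0≤
    cursor-≤-chain {T} chain J0≤ (suc k) k<n {J} loaded with <-or-≥ (lft (T (suc k))) (lft J)
    ... | inj₂ J≤T = J≤T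
    ... | inj₁ T<J with skipped k k<n J loaded (T (suc k)) (proj₁ chain (suc k) k<n) T<J | unset-or-loaded k (ℕₚ.<⇒≤ k<n)
    ...   | T≤hi | inj₁ unset with ≤ᵉ-∞ (subst (λ e → fin (lft (T (suc k))) ≤ᵉ hi e) unset T≤hi)
    ...     | ()
    cursor-≤-chain {T} chain J0≤ (suc k) k<n {J} loaded | inj₁ T<J | T≤hi | inj₂ (J' , loaded') =
      ⊥-elim (<⇒≱ (proj₂ chain k k<n) (≤-trans T≤J' J'≤T))
      where
        T≤J' : lft (T (suc k)) ≤ rgt J'
        T≤J' = fin-≤⁻ (subst (λ e → fin (lft (T (suc k))) ≤ᵉ hi e) loaded' T≤hi)
        J'≤T : rgt J' ≤ rgt (T k)
        J'≤T = antichain-rgt-≤ (list-antichain (ℕₚ.<⇒≤ k<n)) (loaded∈list (ℕₚ.<⇒≤ k<n) loaded')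
                 (proj₁ chain k (ℕₚ.<⇒≤ k<n)) (cursor-≤-chain chain J0≤ k (ℕₚ.<⇒≤ k<n) loaded')

  -- Above index i+1 the cursors still form the previous greedy chain; the cursor at i+1 is either
  -- still part of it or not yet separated from the cursor at i.
  record Scanning (c : ℕ → EI) (r : ℕ → List Iv) (i : ℕ) (J0 : Iv) : Set where
    field
      i≤n : i ℕ.≤ n
      cursors : Cursors c r J0
      separatedBelow : ∀ k → k ℕ.< i → c k ≪ᵉ c (suc k)
      separatedAbove : ∀ k → suc i ℕ.< k → k ℕ.< n → Loaded (c k) → c k ≪ᵉ c (suc k)
      separatedNext : suc i ℕ.< n → c i ≪ᵉ c (suc i) → c (suc i) ≪ᵉ c (suc (suc i))

  cursorAt-advance : ∀ {k e J Js} → k ℕ.≤ n → CursorAt k e (J ∷ Js) → Cursor k J Js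
  cursorAt-advance k≤n (inj₁ (_ , list≡)) = cursor-start k≤n (sym list≡)
  cursorAt-advance _ (inj₂ (_ , _ , cursor)) = CursorStep.step cursor

  cursorAt-advance-lo : ∀ {k e J Js} → CursorAt k e (J ∷ Js) → lo e <ᵉ fin (lft J)
  cursorAt-advance-lo (inj₁ (refl , _)) = -∞<fin
  cursorAt-advance-lo (inj₂ (_ , refl , cursor)) = fin<fin (CursorStep.advances cursor)

  cursorAt-advance-hi : ∀ {k e J Js} → k ℕ.≤ n → CursorAt k e (J ∷ Js) → hi e ≤ᵉ fin (rgt J)
  cursorAt-advance-hi _ (inj₁ (refl , _)) = -∞-≤
  cursorAt-advance-hi k≤n (inj₂ (_ , refl , cursor)) =
    inj₁ (fin<fin (antichain-rgt-< (list-antichain k≤n) (Cursor.current∈ cursor)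
                     (Cursor.current∈ (CursorStep.step cursor)) (CursorStep.advances cursor)))

  cursorAt-skipped : ∀ {k e J Js K} → k ℕ.≤ n → CursorAt k e (J ∷ Js) → K ∈ list k → lft K < lft J →
                     Σ Iv λ Jo → (e ≡ finItv Jo) × (lft K ≤ lft Jo)
  cursorAt-skipped _ (inj₂ (Jo , loaded , cursor)) K∈ ℓ<ℓ = Jo , loaded , CursorStep.skipped-≤ cursor K∈ ℓ<ℓ
  cursorAt-skipped k≤n (inj₁ (_ , list≡)) K∈ ℓ<ℓ
    with subst (_ ∈_) (sym list≡) K∈ | subst (AllPairs StartsBefore) (sym list≡) (antichain-sorted (list-antichain k≤n))
  ... | here refl | _ = ⊥-elim (<-irrefl ℓ<ℓ)
  ... | there K∈Js | J<Js ∷ _ = ⊥-elim (asym ℓ<ℓ (All.lookup J<Js K∈Js))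

  -- pending Jp L: the paper's [ℓ'..r'] is [ℓ Jp .. r L] and its bound b is ℓ L
  data Candidate : Set where
    none : Candidate
    pending : Iv → Iv → Candidate

  bound : Candidate → Ext A
  bound none = +∞
  bound (pending _ L) = fin (lft L)

  bound≢-∞ : ∀ m → bound m ≢ -∞
  bound≢-∞ none ()
  bound≢-∞ (pending _ _) ()

  BoundInvariant : (ℕ → EI) → ℕ → Candidate → Set
  BoundInvariant c i none = ⊤
  BoundInvariant c i (pending _ L) =
    (i ℕ.< n → c n ≡ finItv L) × (i ≡ n → fin (lft L) <ᵉ lo (c n)) × (fin (lft L) ≤ᵉ lo (c n))

  BoundInvariantDo : (ℕ → EI) → ℕ → Candidate → Set
  BoundInvariantDo c i none = ⊤
  BoundInvariantDo c i (pending _ L) = (suc i ℕ.< n → c n ≡ finItv L) × (fin (lft L) ≤ᵉ lo (c n))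

  boundInvariant⇒Do : ∀ {c i} m → BoundInvariant c i m → BoundInvariantDo c i m
  boundInvariant⇒Do none _ = tt
  boundInvariant⇒Do {i = i} (pending _ L) (last≡ , _ , L≤) = last≡ ∘ ℕₚ.<-trans (ℕₚ.n<1+n i) , L≤

  EndsAtCandidate : (ℕ → EI) → Candidate → Set
  EndsAtCandidate c none = ⊤
  EndsAtCandidate c (pending _ L) = c n ≡ finItv L

  exit-before-end : ∀ {c i} m → BoundInvariant c i m → i ℕ.< n → EndsAtCandidate c m
  exit-before-end none _ _ = tt
  exit-before-end (pending _ _) (last≡ , _) i<n = last≡ i<n

  -- Returning with bound b is justified: the last interval of every chain from J0 on starts after b,
  -- so the pending candidate, whose last interval starts at b, is minimal.
  ChainsEndBeyond : Iv → Ext A → Set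
  ChainsEndBeyond J0 b = ∀ T → Chain T → lft J0 ≤ lft (T 0) → b <ᵉ fin (lft (T n))

  GreedyChain : (ℕ → EI) → (ℕ → List Iv) → Iv → Set
  GreedyChain c r J0 = Cursors c r J0 × (∀ k → k ℕ.< n → c k ≪ᵉ c (suc k))

  InnerOutcome : Iv → Candidate → ℕ → Res _<_ sto → Set
  InnerOutcome J0 m B (ret (st c r zero)) = ⊥
  InnerOutcome J0 m B (ret (st c r (suc i))) = Scanning c r i J0 × (totalUnread r ℕ.≤ B) × ChainsEndBeyond J0 (bound m)
  InnerOutcome J0 m B (exit (st c r i)) = GreedyChain c r J0 × (totalUnread r ℕ.≤ B) × EndsAtCandidate c m

  innerOutcome-weaken : ∀ {J0 m B B'} res → InnerOutcome J0 m B res → B ℕ.≤ B' → InnerOutcome J0 m B' res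
  innerOutcome-weaken (ret (st c r (suc i))) (scanning , ≤B , beyond) B≤B' = scanning , ℕₚ.≤-trans ≤B B≤B' , beyond
  innerOutcome-weaken (exit (st c r i)) (greedy , ≤B , ends) B≤B' = greedy , ℕₚ.≤-trans ≤B B≤B' , ends

  outcome-weaken : ∀ {J0 m B B'} {P : Res _<_ sto → Set} → B ℕ.≤ B' →
                   Σ (Res _<_ sto) (λ res → P res × InnerOutcome J0 m B res) →
                   Σ (Res _<_ sto) (λ res → P res × InnerOutcome J0 m B' res)
  outcome-weaken B≤B' (res , p , outcome) = res , p , innerOutcome-weaken res outcome B≤B'

  module _ {c r i J0} (scanning : Scanning c r i J0) where
    open Scanning scanning

    scanning-loaded : ∀ k → k ℕ.≤ i → Loaded (c k)
    scanning-loaded zero _ = _ , Cursors.first cursors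
    scanning-loaded (suc k) k<i = separated⇒loaded cursors k (ℕₚ.≤-trans k<i i≤n) (separatedBelow k k<i)

    separated-all : i ℕ.< n → c i ≪ᵉ c (suc i) → ∀ k → k ℕ.< n → c k ≪ᵉ c (suc k)
    separated-all i<n sepᵢ k k<n with ℕₚ.<-cmp k i
    ... | tri< k<i _ _ = separatedBelow k k<i
    ... | tri≈ _ refl _ = sepᵢ
    ... | tri> _ _ i<k = above k i<k k<n
      where
        above : ∀ k → i ℕ.< k → k ℕ.< n → c k ≪ᵉ c (suc k)
        above (suc k) (s≤s i≤k) k<n with ℕₚ.m≤n⇒m<n∨m≡n i≤k
        ... | inj₂ refl = separatedNext k<n sepᵢ
        ... | inj₁ i<k = separatedAbove (suc k) (s≤s i<k) k<n
                           (separated⇒loaded cursors k (ℕₚ.<-trans (ℕₚ.n<1+n k) k<n)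
                             (above k i<k (ℕₚ.<-trans (ℕₚ.n<1+n k) k<n)))

    private
      last≤chain : ∀ {T Ci} → c i ≡ finItv Ci → Chain T → lft J0 ≤ lft (T 0) → rgt Ci ≤ rgt (T i)
      last≤chain loaded chain J0≤ = antichain-rgt-≤ (list-antichain i≤n) (loaded∈list cursors i≤n loaded)
                                      (proj₁ chain i i≤n) (cursor-≤-chain cursors chain J0≤ i i≤n loaded)

    bound-reached : ∀ m → BoundInvariant c i m → bound m ≤ᵉ hi (c i) → ChainsEndBeyond J0 (bound m)
    bound-reached none _ +∞≤ with scanning-loaded i ℕₚ.≤-refl
    ... | _ , loaded with +∞-≤ᵉ (subst (+∞ ≤ᵉ_) (hi-finItv loaded) +∞≤)
    ...   | ()
    bound-reached (pending _ L) (_ , L<last , _) L≤hi T chain J0≤ with scanning-loaded i ℕₚ.≤-refl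
    ... | Ci , loaded = fin<fin (L<T (ℕₚ.m≤n⇒m<n∨m≡n i≤n))
      where
        L≤Ci : lft L ≤ rgt Ci
        L≤Ci = fin-≤⁻ (subst (fin (lft L) ≤ᵉ_) (hi-finItv loaded) L≤hi)
        L<T : (i ℕ.< n) ⊎ (i ≡ n) → lft L < lft (T n)
        L<T (inj₁ i<n) = ≤-<-trans (≤-trans L≤Ci (last≤chain loaded chain J0≤)) (chain-< chain i<n ℕₚ.≤-refl)
        L<T (inj₂ refl) = <-≤-trans (fin-<⁻ (subst (fin (lft L) <ᵉ_) (lo-finItv loaded) (L<last refl)))
                                     (cursor-≤-chain cursors chain J0≤ i i≤n loaded)

    exit-at-end : ∀ m → BoundInvariant c i m → hi (c i) <ᵉ bound m → i ≡ n → EndsAtCandidate c m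
    exit-at-end none _ _ _ = tt
    exit-at-end (pending _ L) (_ , L<last , _) hi<L refl with scanning-loaded i ℕₚ.≤-refl
    ... | Ci , loaded = ⊥-elim (<-irrefl (<-trans L<Ci (≤-<-trans Ci-nonEmpty Ci<L)))
      where
        L<Ci = fin-<⁻ (subst (fin (lft L) <ᵉ_) (lo-finItv loaded) (L<last refl))
        Ci<L = fin-<⁻ (subst (_<ᵉ fin (lft L)) (hi-finItv loaded) hi<L)
        Ci-nonEmpty = antichain-nonEmpty (list-antichain i≤n) (loaded∈list cursors i≤n loaded)

    module _ (i<n : i ℕ.< n) (overlaps : lo (c (suc i)) ≤ᵉ hi (c i)) where

      overlapping-<-chain : ∀ {J T} → c (suc i) ≡ finItv J → Chain T → lft J0 ≤ lft (T 0) → lft J < lft (T (suc i))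
      overlapping-<-chain loaded chain J0≤ with scanning-loaded i ℕₚ.≤-refl
      ... | Ci , loadedᵢ = ≤-<-trans J≤Ci (≤-<-trans (last≤chain loadedᵢ chain J0≤) (proj₂ chain i i<n))
        where J≤Ci = fin-≤⁻ (subst₂ _≤ᵉ_ (lo-finItv loaded) (hi-finItv loadedᵢ) overlaps)

      bound-reached-next : ∀ m → BoundInvariantDo c i m → bound m ≤ᵉ hi (c (suc i)) → ChainsEndBeyond J0 (bound m)
      bound-reached-next m inv b≤hi T chain J0≤ with unset-or-loaded cursors (suc i) i<n
      ... | inj₁ unset = ⊥-elim (bound≢-∞ m (≤ᵉ-∞ (subst (λ e → bound m ≤ᵉ hi e) unset b≤hi)))
      ... | inj₂ (J , loaded) = bound-reached-loaded m inv (subst (bound m ≤ᵉ_) (hi-finItv loaded) b≤hi)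
        where
          J<T = overlapping-<-chain loaded chain J0≤
          bound-reached-loaded : ∀ m → BoundInvariantDo c i m → bound m ≤ᵉ fin (rgt J) → bound m <ᵉ fin (lft (T n))
          bound-reached-loaded none _ +∞≤ with +∞-≤ᵉ +∞≤
          ... | ()
          bound-reached-loaded (pending _ L) (_ , L≤last) L≤J with ℕₚ.m≤n⇒m<n∨m≡n i<n
          ... | inj₁ si<n = fin<fin (≤-<-trans (fin-≤⁻ L≤J)
                              (<-trans (antichain-rgt-< (list-antichain i<n) (loaded∈list cursors i<n loaded)
                                                        (proj₁ chain (suc i) i<n) J<T)
                                       (chain-< chain si<n ℕₚ.≤-refl)))
          ... | inj₂ refl = fin<fin (≤-<-trans (fin-≤⁻ (subst (fin (lft L) ≤ᵉ_) (lo-finItv loaded) L≤last)) J<T)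

      exhausted⇒noChain : r (suc i) ≡ [] → ∀ T → Chain T → ¬ (lft J0 ≤ lft (T 0))
      exhausted⇒noChain r≡[] T chain J0≤ with Cursors.cursorAt cursors i i<n
      ... | inj₁ (_ , r≡list) = subst (NaturalAntichain _<_) (trans (sym r≡list) r≡[]) (list-antichain i<n)
      ... | inj₂ (J , loaded , cursor) with Cursor.read-≤ cursor (proj₁ chain (suc i) i<n)
      ...   | inj₁ T∈rest with subst (_ ∈_) r≡[] T∈rest
      ...     | ()
      exhausted⇒noChain r≡[] T chain J0≤ | inj₂ (J , loaded , cursor) | inj₂ T≤J =
        <⇒≱ (overlapping-<-chain loaded chain J0≤) T≤J

  module Advance {c r i J0 J Js} (cursors : Cursors c r J0) (i<n : i ℕ.< n)
                 (overlaps : lo (c (suc i)) ≤ᵉ hi (c i)) (r≡ : r (suc i) ≡ J ∷ Js) where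
    open Cursors cursors

    c' : ℕ → EI
    c' = upd _<_ sto c (suc i) (emb _<_ sto J)

    r' : ℕ → List Iv
    r' = upd _<_ sto r (suc i) Js

    c'-at : c' (suc i) ≡ finItv J
    c'-at = upd-≡ c (suc i) (emb _<_ sto J)

    c'-elsewhere : ∀ {k} → k ≢ suc i → c' k ≡ c k
    c'-elsewhere = upd-≢ c (emb _<_ sto J)

    r'-elsewhere : ∀ {k} → k ≢ suc i → r' k ≡ r k
    r'-elsewhere = upd-≢ r Js

    private
      cursorAtᵢ : CursorAt (suc i) (c (suc i)) (J ∷ Js)
      cursorAtᵢ = subst (CursorAt (suc i) (c (suc i))) r≡ (cursorAt i i<n)
      i≢1+i : i ≢ suc i
      i≢1+i = ℕₚ.<⇒≢ (ℕₚ.n<1+n i)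
      2+i≢1+i : suc (suc i) ≢ suc i
      2+i≢1+i = ℕₚ.>⇒≢ (ℕₚ.n<1+n (suc i))

    skipped-at : ∀ {K} → K ∈ list (suc i) → lft K < lft J → fin (lft K) ≤ᵉ hi (c i)
    skipped-at K∈ K<J with cursorAt-skipped i<n cursorAtᵢ K∈ K<J
    ... | Jo , loaded , inj₁ K<Jo = skipped i i<n Jo loaded _ K∈ K<Jo
    ... | Jo , loaded , inj₂ K≡Jo =
      subst (λ a → fin a ≤ᵉ hi (c i)) (sym K≡Jo) (subst (_≤ᵉ hi (c i)) (lo-finItv loaded) overlaps)

    cursors' : Cursors c' r' J0
    cursors' = record
      { first = trans (c'-elsewhere λ ()) first
      ; firstCursor = subst (Cursor 0 J0) (sym (r'-elsewhere λ ())) firstCursor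
      ; cursorAt = cursorAt'
      ; skipped = skipped'
      }
      where
        cursorAt' : ∀ k → k ℕ.< n → CursorAt (suc k) (c' (suc k)) (r' (suc k))
        cursorAt' k k<n with k ℕ.≟ i
        ... | yes refl = inj₂ (J , c'-at , subst (Cursor (suc i) J) (sym (upd-≡ r (suc i) Js)) (cursorAt-advance i<n cursorAtᵢ))
        ... | no k≢i = subst₂ (CursorAt (suc k)) (sym (c'-elsewhere (k≢i ∘ ℕₚ.suc-injective)))
                                                 (sym (r'-elsewhere (k≢i ∘ ℕₚ.suc-injective))) (cursorAt k k<n)
        skipped' : ∀ k → k ℕ.< n → SkippedBelow (suc k) (c' (suc k)) (hi (c' k))
        skipped' k k<n with k ℕ.≟ i
        ... | yes refl = λ J' loaded K K∈ K<J' →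
          subst (λ e → fin (lft K) ≤ᵉ hi e) (sym (c'-elsewhere i≢1+i))
            (skipped-at K∈ (subst (λ L → lft K < lft L) (finItv-injective (trans (sym loaded) c'-at)) K<J'))
        ... | no k≢i with k ℕ.≟ suc i
        ...   | yes refl = λ J' loaded K K∈ K<J' →
          subst (fin (lft K) ≤ᵉ_) (sym (hi-finItv c'-at))
            (≤ᵉ-trans (skipped (suc i) k<n J' (trans (sym (c'-elsewhere 2+i≢1+i)) loaded) K K∈ K<J')
                      (cursorAt-advance-hi i<n cursorAtᵢ))
        ...   | no k≢1+i = subst₂ (SkippedBelow (suc k)) (sym (c'-elsewhere (k≢i ∘ ℕₚ.suc-injective)))
                                                         (cong hi (sym (c'-elsewhere k≢1+i))) (skipped k k<n)

    lo-increases : lo (c (suc i)) <ᵉ lo (c' (suc i))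
    lo-increases = subst (lo (c (suc i)) <ᵉ_) (sym (lo-finItv c'-at)) (cursorAt-advance-lo cursorAtᵢ)

    lo-mono : ∀ k → lo (c k) ≤ᵉ lo (c' k)
    lo-mono k with k ℕ.≟ suc i
    ... | yes refl = inj₁ lo-increases
    ... | no k≢1+i = inj₂ (cong lo (sym (c'-elsewhere k≢1+i)))

    unread-< : totalUnread r' ℕ.< totalUnread r
    unread-< = ℕₚ.≤-reflexive (sym (lengthSum-upd-tail r (suc i) J Js (suc n) (s≤s i<n) r≡))

    unread-shrinks : totalUnread r' ℕ.≤ totalUnread r
    unread-shrinks = ℕₚ.<⇒≤ unread-<

    separated-preserved : ∀ {k k'} → k ≢ suc i → k' ≢ suc i → c k ≪ᵉ c k' → c' k ≪ᵉ c' k'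
    separated-preserved k≢ k'≢ = subst₂ _≪ᵉ_ (sym (c'-elsewhere k≢)) (sym (c'-elsewhere k'≢))

    module _ (scanning : Scanning c r i J0) where
      open Scanning scanning

      stay : fin (lft J) ≤ᵉ hi (c i) → Scanning c' r' i J0
      stay J≤hi = record
        { i≤n = i≤n
        ; cursors = cursors'
        ; separatedBelow = λ k k<i → separated-preserved (ℕₚ.<⇒≢ (ℕₚ.m<n⇒m<1+n k<i)) (ℕₚ.<⇒≢ (s≤s k<i))
                                                         (separatedBelow k k<i)
        ; separatedAbove = λ k 1+i<k k<n loaded →
            separated-preserved (ℕₚ.>⇒≢ 1+i<k) (ℕₚ.>⇒≢ (ℕₚ.m<n⇒m<1+n 1+i<k))
              (separatedAbove k 1+i<k k<n (subst Loaded (c'-elsewhere (ℕₚ.>⇒≢ 1+i<k)) loaded))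
        ; separatedNext = λ _ hi<J →
            ⊥-elim (<ᵉ⇒≱ᵉ (subst₂ _<ᵉ_ (cong hi (c'-elsewhere i≢1+i)) (lo-finItv c'-at) hi<J) J≤hi)
        }

      move : hi (c i) <ᵉ fin (lft J) → Scanning c' r' (suc i) J0
      move hi<J = record
        { i≤n = i<n
        ; cursors = cursors'
        ; separatedBelow = below
        ; separatedAbove = λ k 2+i<k k<n loaded →
            let 1+i<k = ℕₚ.<-trans (ℕₚ.n<1+n (suc i)) 2+i<k in
            separated-preserved (ℕₚ.>⇒≢ 1+i<k) (ℕₚ.>⇒≢ (ℕₚ.m<n⇒m<1+n 1+i<k))
              (separatedAbove k 1+i<k k<n (subst Loaded (c'-elsewhere (ℕₚ.>⇒≢ 1+i<k)) loaded))
        ; separatedNext = λ 2+i<n sep →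
            separated-preserved 2+i≢1+i (ℕₚ.>⇒≢ (ℕₚ.m<n⇒m<1+n (ℕₚ.n<1+n (suc i))))
              (separatedAbove (suc (suc i)) (ℕₚ.n<1+n (suc i)) 2+i<n
                (subst Loaded (c'-elsewhere 2+i≢1+i)
                  (separated⇒loaded cursors' (suc i) (ℕₚ.<-trans (ℕₚ.n<1+n (suc i)) 2+i<n) sep)))
        }
        where
          below : ∀ k → k ℕ.< suc i → c' k ≪ᵉ c' (suc k)
          below k (s≤s k≤i) with ℕₚ.m≤n⇒m<n∨m≡n k≤i
          ... | inj₁ k<i = separated-preserved (ℕₚ.<⇒≢ (ℕₚ.m<n⇒m<1+n k<i)) (ℕₚ.<⇒≢ (s≤s k<i))
                                               (separatedBelow k k<i)
          ... | inj₂ refl = subst₂ _<ᵉ_ (cong hi (sym (c'-elsewhere i≢1+i))) (sym (lo-finItv c'-at)) hi<J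

    stay-overlaps : fin (lft J) ≤ᵉ hi (c i) → lo (c' (suc i)) ≤ᵉ hi (c' i)
    stay-overlaps = subst₂ _≤ᵉ_ (sym (lo-finItv c'-at)) (cong hi (sym (c'-elsewhere i≢1+i)))

    stay-bound : ∀ m → BoundInvariantDo c i m → BoundInvariantDo c' i m
    stay-bound none _ = tt
    stay-bound (pending _ L) (last≡ , L≤) =
      (λ 1+i<n → trans (c'-elsewhere (ℕₚ.>⇒≢ 1+i<n)) (last≡ 1+i<n)) , ≤ᵉ-trans L≤ (lo-mono n)

    move-bound : ∀ m → BoundInvariantDo c i m → BoundInvariant c' (suc i) m
    move-bound none _ = tt
    move-bound (pending _ L) (last≡ , L≤) =
      (λ 1+i<n → trans (c'-elsewhere (ℕₚ.>⇒≢ 1+i<n)) (last≡ 1+i<n)) , L<last , ≤ᵉ-trans L≤ (lo-mono n)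
      where
        L<last : suc i ≡ n → fin (lft L) <ᵉ lo (c' n)
        L<last refl = ≤ᵉ-<ᵉ-trans L≤ lo-increases

  fuel-mono : ∀ {R R' f} k → R' ℕ.≤ R → k + 3 * R ℕ.≤ f → k + 3 * R' ℕ.≤ f
  fuel-mono k R'≤R = ℕₚ.≤-trans (ℕₚ.+-monoʳ-≤ k (ℕₚ.*-monoʳ-≤ 3 R'≤R))

  fuel-drop : ∀ {R R' f} k → R' ℕ.< R → k + 3 * R ℕ.≤ f → k + (3 + 3 * R') ℕ.≤ f
  fuel-drop {R} {R'} k R'<R =
    ℕₚ.≤-trans (ℕₚ.+-monoʳ-≤ k (subst (ℕ._≤ 3 * R) (ℕₚ.*-suc 3 R') (ℕₚ.*-monoʳ-≤ 3 R'<R)))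

  InnerCorrect : Iv → Candidate → (ℕ → List Iv) → Maybe (Res _<_ sto) → Set
  InnerCorrect J0 m r result = Σ (Res _<_ sto) λ res → (result ≡ just res) × InnerOutcome J0 m (totalUnread r) res

  mutual
    inner-correct : ∀ f m {c r i J0} → Scanning c r i J0 → BoundInvariant c i m → 3 + 3 * totalUnread r ℕ.≤ f →
                    InnerCorrect J0 m r (inner _<_ sto f (suc n) (bound m) (st c r (suc i)))
    inner-correct (suc f) m {c} {r} {i} scanning inv (s≤s fuel) with leE _<_ sto (bound m) (hi (c i)) in b≤?
    ... | true = ret (st c r (suc i)) , refl , scanning , ℕₚ.≤-refl ,
                 bound-reached scanning m inv (leE≡true⇒≤ᵉ _ _ b≤?)
    ... | false with i ≡ᵇ n in i≡?
    ...   | true = exit (st c r (suc i)) , refl , (cursors , λ k k<n → separatedBelow k (<n⇒<i k<n)) , ℕₚ.≤-refl ,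
                   exit-at-end scanning m inv (leE≡false⇒>ᵉ _ _ b≤?) (≡ᵇ≡true⇒≡ i n i≡?)
      where
        open Scanning scanning
        <n⇒<i : ∀ {k} → k ℕ.< n → k ℕ.< i
        <n⇒<i = subst (_ ℕ.<_) (sym (≡ᵇ≡true⇒≡ i n i≡?))
    ...   | false with ltE _<_ sto (hi (c i)) (lo (c (suc i))) in sep?
    ...     | true = exit (st c r (suc i)) , refl ,
                     (Scanning.cursors scanning , separated-all scanning i<n (ltE≡true⇒<ᵉ _ _ sep?)) , ℕₚ.≤-refl ,
                     exit-before-end m inv i<n
      where i<n = ℕₚ.≤∧≢⇒< (Scanning.i≤n scanning) (≡ᵇ≡false⇒≢ i n i≡?)
    ...     | false = doLoop-correct f m scanning i<n (ltE≡false⇒≥ᵉ _ _ sep?) (boundInvariant⇒Do m inv) fuel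
      where i<n = ℕₚ.≤∧≢⇒< (Scanning.i≤n scanning) (≡ᵇ≡false⇒≢ i n i≡?)

    doLoop-correct : ∀ f m {c r i J0} → Scanning c r i J0 → (i<n : i ℕ.< n) → lo (c (suc i)) ≤ᵉ hi (c i) →
                     BoundInvariantDo c i m → 2 + 3 * totalUnread r ℕ.≤ f →
                     InnerCorrect J0 m r (doLoop _<_ sto f (suc n) (bound m) (st c r (suc i)))
    doLoop-correct (suc f) m {c} {r} {i} scanning i<n overlaps inv (s≤s fuel)
      with leE _<_ sto (bound m) (hi (c (suc i))) in b≤?
    ... | true = ret (st c r (suc i)) , refl , scanning , ℕₚ.≤-refl ,
                 bound-reached-next scanning i<n overlaps m inv (leE≡true⇒≤ᵉ _ _ b≤?)
    ... | false = doStep-correct f m (r (suc i)) refl scanning i<n overlaps inv fuel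

    doStep-correct : ∀ f m {c r i J0} xs → r (suc i) ≡ xs → Scanning c r i J0 → (i<n : i ℕ.< n) →
                     lo (c (suc i)) ≤ᵉ hi (c i) → BoundInvariantDo c i m → 1 + 3 * totalUnread r ℕ.≤ f →
                     InnerCorrect J0 m r (doStep _<_ sto f (suc n) (bound m) (st c r (suc i)) xs)
    doStep-correct f m {c} {r} {i} [] r≡[] scanning i<n overlaps inv fuel =
      ret (st c r (suc i)) , refl , scanning , ℕₚ.≤-refl ,
      λ T chain J0≤ → ⊥-elim (exhausted⇒noChain scanning i<n overlaps r≡[] T chain J0≤)
    doStep-correct f m {c} {r} {i} (J ∷ Js) r≡ scanning i<n overlaps inv fuel
      -- evaluate the updated cursor arrays at the indices i+1 and i that doStep inspects
      with i ≡ᵇ i | ≡ᵇ-refl i | i ≡ᵇ suc i | ≢⇒≡ᵇ≡false (ℕₚ.<⇒≢ (ℕₚ.n<1+n i))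
    ... | .true | refl | .false | refl with leE _<_ sto (fin (lft J)) (hi (c i)) in J≤?
    ...   | true = outcome-weaken unread-shrinks
                     (doLoop-correct f m (stay scanning J≤hi) i<n (stay-overlaps J≤hi) (stay-bound m inv)
                                     (ℕₚ.m+n≤o⇒n≤o 2 (fuel-drop 1 unread-< fuel)))
      where
        open Advance (Scanning.cursors scanning) i<n overlaps r≡
        J≤hi = leE≡true⇒≤ᵉ _ _ J≤?
    ...   | false = outcome-weaken unread-shrinks
                      (inner-correct f m (move scanning (leE≡false⇒>ᵉ _ _ J≤?)) (move-bound m inv)
                                     (ℕₚ.m+n≤o⇒n≤o 1 (fuel-drop 1 unread-< fuel)))
      where open Advance (Scanning.cursors scanning) i<n overlaps r≡

  data Phase : Set where
    active : Iv → Phase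
    finished : Phase

  Remaining : Phase → Iv → Set
  Remaining (active J0) J = MinimalSpan J × (lft J0 ≤ lft J)
  Remaining finished J = ⊥

  StateInvariant : St _<_ sto → Phase → Set
  StateInvariant (st c r zero) _ = ⊥
  StateInvariant (st c r (suc i)) (active J0) = Scanning c r i J0
  StateInvariant (st c r (suc i)) finished = (c 0 ≡ nullI _<_ sto) × (i ≡ 0)

  UnreadBelow : St _<_ sto → Phase → ℕ → Set
  UnreadBelow (st c r i) (active _) R = totalUnread r ℕ.< R
  UnreadBelow (st c r i) finished R = ⊤

  record Emits (J0s : Iv) (R : ℕ) (J : Iv) (s : St _<_ sto) : Set where
    field
      remaining : Remaining (active J0s) J
      phase : Phase
      invariant : StateInvariant s phase
      unreadBelow : UnreadBelow s phase R
      rest-covered : ∀ J' → Remaining (active J0s) J' → (J' ≡ J) ⊎ Remaining phase J'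
      rest-after : ∀ J' → Remaining phase J' → Remaining (active J0s) J' × (lft J < lft J')

  NextCorrect : Iv → ℕ → EI × St _<_ sto → Set
  NextCorrect J0s R (out , s) =
    ((out ≡ nullI _<_ sto) × (∀ J → ¬ Remaining (active J0s) J)) ⊎
    (Σ Iv λ J → (out ≡ emb _<_ sto J) × Emits J0s R J s)

  record Pending (J0s J0 Jp L : Iv) : Set where
    field
      before : lft Jp < lft J0
      next : ∀ {K} → K ∈ list 0 → lft Jp < lft K → lft J0 ≤ lft K
      span : ChainSpan (lft Jp , rgt L)
      last∈ : L ∈ list n
      last-≤ : ∀ T → Chain T → lft Jp ≤ lft (T 0) → lft L ≤ lft (T n)
      minimal-after : ∀ J → MinimalSpan J → lft J0s ≤ lft J → lft Jp ≤ lft J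
      start : lft J0s ≤ lft Jp

  OuterInvariant : Iv → ℕ → Iv → Candidate → EI → (ℕ → List Iv) → Set
  OuterInvariant J0s R J0 none out r = (out ≡ nullI _<_ sto) × (J0 ≡ J0s) × (totalUnread r ℕ.≤ R)
  OuterInvariant J0s R J0 (pending Jp L) out r =
    (out ≡ emb _<_ sto (lft Jp , rgt L)) × Pending J0s J0 Jp L × (totalUnread r ℕ.< R)

  outerInvariant-unread : ∀ {J0s R J0} m {out r} → OuterInvariant J0s R J0 m out r → totalUnread r ℕ.≤ R
  outerInvariant-unread none (_ , _ , ≤R) = ≤R
  outerInvariant-unread (pending _ _) (_ , _ , <R) = ℕₚ.<⇒≤ <R

  chainSpan-ends : ∀ {J} → ChainSpan J → Σ (ℕ → Iv) λ T → Chain T × (lft J ≡ lft (T 0)) × (rgt J ≡ rgt (T n))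
  chainSpan-ends (T , chain , refl) = T , chain , refl , refl

  return-correct : ∀ J0s R m {r J0} out → OuterInvariant J0s R J0 m out r →
                   ∀ {c' r' i'} → Scanning c' r' i' J0 → totalUnread r' ℕ.≤ totalUnread r →
                   ChainsEndBeyond J0 (bound m) → NextCorrect J0s R (out , st c' r' (suc i'))
  return-correct J0s R none out (out≡ , refl , _) _ _ beyond = inj₁ (out≡ , none-remaining)
    where
      none-remaining : ∀ J → ¬ Remaining (active J0s) J
      none-remaining J ((span , _) , J0s≤J) with chainSpan-ends span
      ... | T , chain , ℓ≡ , _ with beyond T chain (subst (lft J0s ≤_) ℓ≡ J0s≤J)
      ...   | ()
  return-correct J0s R (pending Jp L) {J0 = J0} out (out≡ , facts , <R) scanning ≤r beyond =
    inj₂ (J , out≡ , record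
      { remaining = minimal , start
      ; phase = active J0
      ; invariant = scanning
      ; unreadBelow = ℕₚ.≤-<-trans ≤r <R
      ; rest-covered = covered
      ; rest-after = λ J' (minimal' , J0≤) →
          (minimal' , ≤-trans start (inj₁ (<-≤-trans before J0≤))) , <-≤-trans before J0≤
      })
    where
      open Pending facts
      J : Iv
      J = lft Jp , rgt L
      minimal : MinimalSpan J
      minimal = span , below-J
        where
          below-J : ∀ J' → ChainSpan J' → J' ⊑ J → J ⊑ J'
          below-J _ (T , chain , refl) (inj₂ Jp≡T , _) =
            inj₂ (sym Jp≡T) , antichain-rgt-≤ (list-antichain ℕₚ.≤-refl) last∈ (proj₁ chain n ℕₚ.≤-refl)
                                (last-≤ T chain (inj₂ Jp≡T))
          below-J _ (T , chain , refl) (inj₁ Jp<T , T≤L) =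
            ⊥-elim (<⇒≱ (antichain-rgt-< (list-antichain ℕₚ.≤-refl) last∈ (proj₁ chain n ℕₚ.≤-refl)
                          (fin-<⁻ (beyond T chain (next (proj₁ chain 0 z≤n) Jp<T)))) T≤L)
      covered : ∀ J' → Remaining (active J0s) J' → (J' ≡ J) ⊎ Remaining (active J0) J'
      covered J' (minimal' , J0s≤J') with minimal-after J' minimal' J0s≤J'
      ... | inj₂ Jp≡J' = inj₁ (sym (minimalSpan-unique minimal minimal' Jp≡J'))
      ... | inj₁ Jp<J' with chainSpan-ends (proj₁ minimal')
      ...   | T , chain , ℓ≡ , _ =
        inj₂ (minimal' , subst (lft J0 ≤_) (sym ℓ≡) (next (proj₁ chain 0 z≤n) (subst (lft Jp <_) ℓ≡ Jp<J')))

  module AfterExit {c r J0} (greedy : GreedyChain c r J0) where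
    private
      cursors = proj₁ greedy
      separated = proj₂ greedy
    open Cursors cursors

    loaded : ∀ k → k ℕ.≤ n → Loaded (c k)
    loaded zero _ = J0 , first
    loaded (suc k) k<n = separated⇒loaded cursors k k<n (separated k k<n)

    toItv : EI → Iv
    toItv (fin a , fin b) = a , b
    toItv _ = J0

    G : ℕ → Iv
    G k = toItv (c k)

    c≡T : ∀ k → k ℕ.≤ n → c k ≡ finItv (G k)
    c≡T k k≤n with loaded k k≤n
    ... | _ , c≡ = trans c≡ (cong finItv (sym (cong toItv c≡)))

    last : Iv
    last = G n

    c-last : c n ≡ finItv last
    c-last = c≡T n ℕₚ.≤-refl

    last∈ : last ∈ list n
    last∈ = loaded∈list cursors ℕₚ.≤-refl c-last

    chain : Chain G
    chain = (λ k k≤n → loaded∈list cursors k≤n (c≡T k k≤n)) ,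
            (λ k k<n → fin-<⁻ (subst₂ _<ᵉ_ (hi-finItv (c≡T k (ℕₚ.<⇒≤ k<n))) (lo-finItv (c≡T (suc k) k<n))
                                          (separated k k<n)))

    candidate : Iv
    candidate = lft J0 , rgt last

    candidate-span : ChainSpan candidate
    candidate-span = G , chain , cong (_, rgt last) (cong lft (sym (cong toItv first)))

    last-≤ : ∀ T' → Chain T' → lft J0 ≤ lft (T' 0) → lft last ≤ lft (T' n)
    last-≤ T' chain' J0≤ = cursor-≤-chain cursors chain' J0≤ n ℕₚ.≤-refl c-last

    output≡ : (lo (c 0) , hi (c n)) ≡ emb _<_ sto candidate
    output≡ = cong₂ _,_ (lo-finItv first) (hi-finItv c-last)

    -- A minimal span starting strictly between Jp and J0 does not exist, and one starting at Jp would
    -- contain the new candidate, which ends at the same L.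
    first-bound : ∀ J0s R m {out r₀} → OuterInvariant J0s R J0 m out r₀ → EndsAtCandidate c m →
                  (∀ J → MinimalSpan J → lft J0s ≤ lft J → lft J0 ≤ lft J) × (lft J0s ≤ lft J0)
    first-bound J0s R none (_ , refl , _) _ = (λ _ _ J0s≤J → J0s≤J) , ≤-refl
    first-bound J0s R (pending Jp L) (_ , facts , _) c-L = J0≤ , ≤-trans start (inj₁ before)
      where
        open Pending facts using (before; next; minimal-after; start) renaming (last∈ to L∈; last-≤ to L-≤)
        last≡L : last ≡ L
        last≡L = finItv-injective (trans (sym c-last) c-L)
        J0≤ : ∀ J → MinimalSpan J → lft J0s ≤ lft J → lft J0 ≤ lft J
        J0≤ J minimal' J0s≤J with <-or-≥ (lft J) (lft J0)
        ... | inj₂ J0≤J = J0≤J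
        ... | inj₁ J<J0 with chainSpan-ends (proj₁ minimal')
        ...   | T' , chain' , ℓ≡ , r≡ with subst (lft Jp ≤_) ℓ≡ (minimal-after J minimal' J0s≤J)
        ...     | inj₁ Jp<T' = ⊥-elim (<⇒≱ J<J0 (subst (lft J0 ≤_) (sym ℓ≡) (next (proj₁ chain' 0 z≤n) Jp<T')))
        ...     | inj₂ Jp≡T' =
          ⊥-elim (<⇒≱ J<J0 (proj₁ (proj₂ minimal' candidate candidate-span (inj₁ J<J0 , last≤J))))
          where
            last≤J : rgt last ≤ rgt J
            last≤J = subst₂ _≤_ (cong rgt (sym last≡L)) (sym r≡)
                       (antichain-rgt-≤ (list-antichain ℕₚ.≤-refl) L∈ (proj₁ chain' n ℕₚ.≤-refl)
                                        (L-≤ T' chain' (inj₂ Jp≡T')))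

    exhausted-correct : ∀ J0s R m {out r₀} → OuterInvariant J0s R J0 m out r₀ → EndsAtCandidate c m → r 0 ≡ [] →
                        NextCorrect J0s R ((lo (c 0) , hi (c n)) , st (upd _<_ sto c 0 (nullI _<_ sto)) r 1)
    exhausted-correct J0s R m inv c-L r₀≡[] = inj₂ (candidate , output≡ , record
      { remaining = (candidate-span , minimal) , proj₂ bounds
      ; phase = finished
      ; invariant = upd-≡ c 0 (nullI _<_ sto) , refl
      ; unreadBelow = tt
      ; rest-covered = covered
      ; rest-after = λ _ ()
      })
      where
        bounds = first-bound J0s R m inv c-L
        at-J0 : ∀ {K} → K ∈ list 0 → lft J0 ≤ lft K → lft K ≡ lft J0
        at-J0 K∈ J0≤K with Cursor.read-≤ firstCursor K∈
        ... | inj₁ K∈rest with subst (_ ∈_) r₀≡[] K∈rest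
        ...   | ()
        at-J0 K∈ J0≤K | inj₂ K≤J0 = ≤-antisym K≤J0 J0≤K
        minimal : ∀ J' → ChainSpan J' → J' ⊑ candidate → candidate ⊑ J'
        minimal _ (T' , chain' , refl) (J0≤T' , _) =
          inj₂ (at-J0 (proj₁ chain' 0 z≤n) J0≤T') ,
          antichain-rgt-≤ (list-antichain ℕₚ.≤-refl) last∈ (proj₁ chain' n ℕₚ.≤-refl) (last-≤ T' chain' J0≤T')
        covered : ∀ J' → Remaining (active J0s) J' → (J' ≡ candidate) ⊎ ⊥
        covered J' (minimal' , J0s≤J') with chainSpan-ends (proj₁ minimal')
        ... | T' , chain' , ℓ≡ , _ =
          inj₁ (sym (minimalSpan-unique ((candidate-span , minimal)) minimal'
                       (sym (trans ℓ≡ (at-J0 (proj₁ chain' 0 z≤n)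
                                             (subst (lft J0 ≤_) ℓ≡ (proj₁ bounds J' minimal' J0s≤J')))))))

    module AdvanceFirst {J Js} (r₀≡ : r 0 ≡ J ∷ Js) where
      c' : ℕ → EI
      c' = upd _<_ sto c 0 (emb _<_ sto J)

      r' : ℕ → List Iv
      r' = upd _<_ sto r 0 Js

      private
        cursor₀ : Cursor 0 J0 (J ∷ Js)
        cursor₀ = subst (Cursor 0 J0) r₀≡ firstCursor
        open CursorStep cursor₀ using (advances; step)
        c'-first : c' 0 ≡ finItv J
        c'-first = upd-≡ c 0 (emb _<_ sto J)
        c'-elsewhere : ∀ {k} → k ≢ 0 → c' k ≡ c k
        c'-elsewhere = upd-≢ c (emb _<_ sto J)
        separated-kept : ∀ {k k'} → k ≢ 0 → k' ≢ 0 → c k ≪ᵉ c k' → c' k ≪ᵉ c' k'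
        separated-kept k≢ k'≢ = subst₂ _≪ᵉ_ (sym (c'-elsewhere k≢)) (sym (c'-elsewhere k'≢))

      scanning : Scanning c' r' 0 J
      scanning = record
        { i≤n = z≤n
        ; cursors = record
            { first = c'-first
            ; firstCursor = subst (Cursor 0 J) (sym (upd-≡ r 0 Js)) step
            ; cursorAt = λ k k<n → subst₂ (CursorAt (suc k)) (sym (c'-elsewhere λ ())) (sym (upd-≢ r {0} Js λ ()))
                                          (cursorAt k k<n)
            ; skipped = skipped'
            }
        ; separatedBelow = λ _ ()
        ; separatedAbove = λ k 1<k k<n _ → separated-kept (ℕₚ.m<n⇒n≢0 1<k) (λ ()) (separated k k<n)
        ; separatedNext = λ 1<n _ → separated-kept (λ ()) (λ ()) (separated 1 1<n)
        }
        where
          skipped' : ∀ k → k ℕ.< n → SkippedBelow (suc k) (c' (suc k)) (hi (c' k))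
          skipped' k k<n with k ℕ.≟ 0
          ... | yes refl = λ J' loaded K K∈ K<J' →
            subst (fin (lft K) ≤ᵉ_) (sym (hi-finItv c'-first))
              (≤ᵉ-trans (skipped 0 k<n J' (trans (sym (c'-elsewhere λ ())) loaded) K K∈ K<J')
                        (subst (_≤ᵉ fin (rgt J)) (sym (hi-finItv first))
                          (inj₁ (fin<fin (antichain-rgt-< (list-antichain z≤n) (Cursor.current∈ cursor₀)
                                                          (Cursor.current∈ step) advances)))))
          ... | no k≢0 = subst₂ (SkippedBelow (suc k)) (sym (c'-elsewhere λ ())) (cong hi (sym (c'-elsewhere k≢0)))
                                (skipped k k<n)

      bound-invariant : BoundInvariant c' 0 (pending J0 last)
      bound-invariant = (λ 0<n → trans (c'-elsewhere (ℕₚ.m<n⇒n≢0 0<n)) c-last) , last<lo , last≤lo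
        where
          last<lo : 0 ≡ n → fin (lft last) <ᵉ lo (c' n)
          last<lo 0≡n = subst (λ k → fin (lft last) <ᵉ lo (c' k)) 0≡n
                          (subst (fin (lft last) <ᵉ_) (sym (lo-finItv c'-first))
                            (fin<fin (subst (λ L → lft L < lft J) (sym last≡J0) advances)))
            where
              last≡J0 : last ≡ J0
              last≡J0 = finItv-injective (trans (sym (subst (λ k → c k ≡ finItv last) (sym 0≡n) c-last)) first)
          last≤lo : fin (lft last) ≤ᵉ lo (c' n)
          last≤lo with n ℕ.≟ 0
          ... | yes n≡0 = inj₁ (last<lo (sym n≡0))
          ... | no n≢0 = inj₂ (sym (trans (cong lo (c'-elsewhere n≢0)) (lo-finItv c-last)))

      pending-facts : ∀ J0s R m {out r₀} → OuterInvariant J0s R J0 m out r₀ → EndsAtCandidate c m →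
                      Pending J0s J J0 last
      pending-facts J0s R m inv c-L = record
        { before = advances
        ; next = CursorStep.next-≤ cursor₀
        ; span = candidate-span
        ; last∈ = last∈
        ; last-≤ = last-≤
        ; minimal-after = proj₁ bounds
        ; start = proj₂ bounds
        }
        where bounds = first-bound J0s R m inv c-L

      unread-< : totalUnread r' ℕ.< totalUnread r
      unread-< = ℕₚ.≤-reflexive (sym (lengthSum-upd-tail r 0 J Js (suc n) (s≤s z≤n) r₀≡))

  NextResult : Iv → ℕ → Maybe (EI × St _<_ sto) → Set
  NextResult J0s R result = Σ (EI × St _<_ sto) λ x → (result ≡ just x) × NextCorrect J0s R x

  mutual
    outer-correct : ∀ f J0s R m {c r i J0} out b → b ≡ bound m → Scanning c r i J0 → BoundInvariant c i m →
                    OuterInvariant J0s R J0 m out r → 4 + 3 * totalUnread r ℕ.≤ f →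
                    NextResult J0s R (outer _<_ sto f (suc n) out b (st c r (suc i)))
    outer-correct (suc f) J0s R m out _ refl scanning inv outerInv (s≤s fuel) with inner-correct f m scanning inv fuel
    ... | res , inner≡ , outcome with afterInner-correct f J0s R m out outerInv fuel res outcome
    ...   | x , after≡ , correct = x , trans (cong (afterInner _<_ sto f (suc n) out) inner≡) after≡ , correct

    afterInner-correct : ∀ f J0s R m {r J0} out → OuterInvariant J0s R J0 m out r → 3 + 3 * totalUnread r ℕ.≤ f →
                         ∀ res → InnerOutcome J0 m (totalUnread r) res →
                         NextResult J0s R (afterInner _<_ sto f (suc n) out (just res))
    afterInner-correct f J0s R m out outerInv fuel (ret (st c' r' (suc i'))) (scanning , ≤r , beyond) =
      (out , st c' r' (suc i')) , refl , return-correct J0s R m out outerInv scanning ≤r beyond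
    afterInner-correct f J0s R m out outerInv fuel (exit (st c' r' i')) (greedy , ≤r , ends) =
      outerTail-correct f J0s R m out outerInv fuel greedy ≤r ends (r' 0) refl

    outerTail-correct : ∀ f J0s R m {r J0} out → OuterInvariant J0s R J0 m out r → 3 + 3 * totalUnread r ℕ.≤ f →
                        ∀ {c' r'} → GreedyChain c' r' J0 → totalUnread r' ℕ.≤ totalUnread r → EndsAtCandidate c' m →
                        ∀ xs → r' 0 ≡ xs →
                        NextResult J0s R (outerTail _<_ sto f (suc n) (lo (c' 0) , hi (c' n)) (lo (c' n)) (st c' r' 1) xs)
    outerTail-correct f J0s R m out outerInv fuel greedy ≤r ends [] r₀≡[] =
      _ , refl , AfterExit.exhausted-correct greedy J0s R m outerInv ends r₀≡[]
    outerTail-correct f J0s R m {r} out outerInv fuel greedy ≤r ends (J ∷ Js) r₀≡ =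
      outer-correct f J0s R (pending _ last) _ _ (lo-finItv c-last) scanning bound-invariant
                    (output≡ , pending-facts J0s R m outerInv ends , <R)
                    (ℕₚ.m+n≤o⇒n≤o 2 (fuel-drop 3 <r fuel))
      where
        open AfterExit greedy
        open AdvanceFirst r₀≡
        <r = ℕₚ.<-≤-trans unread-< ≤r
        <R = ℕₚ.<-≤-trans <r (outerInvariant-unread m outerInv)

  calls-step : ∀ F k s {o s' os} → nextCall _<_ sto F (suc n) s ≡ just (o , s') →
               calls _<_ sto F (suc n) k s' ≡ just os → calls _<_ sto F (suc n) (suc k) s ≡ just (o ∷ os)
  calls-step F k s next≡ calls≡ rewrite next≡ | calls≡ = refl

  finished-next : ∀ F {c r} → c 0 ≡ nullI _<_ sto → 2 ℕ.≤ F →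
                  nextCall _<_ sto F (suc n) (st c r 1) ≡ just (nullI _<_ sto , st c r 1)
  finished-next (suc (suc F)) {c} c₀≡ (s≤s (s≤s z≤n)) with c 0 | c₀≡
  ... | _ | refl = refl

  Enumerates : Phase → ℕ → St _<_ sto → Set
  Enumerates phase F s = Σ (List Iv) λ outs →
    Unique outs × (∀ J → (J ∈ outs → Remaining phase J) × (Remaining phase J → J ∈ outs)) ×
    (calls _<_ sto F (suc n) (suc (length outs)) s ≡ just (map (emb _<_ sto) outs ++ (nullI _<_ sto ∷ [])))

  calls-correct : ∀ F R s phase → StateInvariant s phase → UnreadBelow s phase (suc R) → 4 + 3 * R ℕ.≤ F →
                  Enumerates phase F s
  calls-correct F R (st c r (suc i)) finished (c₀≡ , refl) _ fuel =
    [] , [] , (λ _ → (λ ()) , λ ()) , calls-step F 0 _ (finished-next F c₀≡ (ℕₚ.m+n≤o⇒m≤o 2 fuel)) refl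
  calls-correct F R (st c r (suc i)) (active J0) scanning <R fuel
    with outer-correct F J0 R none (nullI _<_ sto) +∞ refl scanning tt (refl , refl , ℕₚ.≤-pred <R)
                       (fuel-mono 4 (ℕₚ.≤-pred <R) fuel)
  ... | (_ , s') , next≡ , inj₁ (refl , none-remaining) =
    [] , [] , (λ J → (λ ()) , ⊥-elim ∘ none-remaining J) , calls-step F 0 _ next≡ refl
  ... | (_ , s') , next≡ , inj₂ (J , refl , emits) with continue R fuel s' phase invariant unreadBelow
    where
      open Emits emits
      continue : ∀ R → 4 + 3 * R ℕ.≤ F → ∀ s' phase → StateInvariant s' phase → UnreadBelow s' phase R →
                 Enumerates phase F s'
      continue R fuel s' finished inv _ = calls-correct F R s' finished inv tt fuel
      continue (suc R) fuel s'@(st _ _ _) (active J1) inv <R =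
        calls-correct F R s' (active J1) inv <R (fuel-mono 4 (ℕₚ.n≤1+n R) fuel)
  ... | outs , unique , members , calls≡ =
    J ∷ outs , J∉outs ∷ unique , membership , calls-step F (suc (length outs)) _ next≡ calls≡
    where
      open Emits emits
      J∉outs : All (J ≢_) outs
      J∉outs = All.tabulate λ J'∈ J≡J' →
        <-irrefl (subst (λ K → lft J < lft K) (sym J≡J') (proj₂ (rest-after _ (proj₁ (members _) J'∈))))
      membership : ∀ J' → (J' ∈ J ∷ outs → Remaining (active J0) J') × (Remaining (active J0) J' → J' ∈ J ∷ outs)
      membership J' = sound , complete
        where
          sound : J' ∈ J ∷ outs → Remaining (active J0) J'
          sound (here refl) = remaining
          sound (there J'∈) = proj₁ (rest-after J' (proj₁ (members J') J'∈))
          complete : Remaining (active J0) J' → J' ∈ J ∷ outs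
          complete rem with rest-covered J' rem
          ... | inj₁ refl = here refl
          ... | inj₂ rem' = there (proj₂ (members J') rem')

  module Start {J Js} (list₀≡ : list 0 ≡ J ∷ Js) where
    c₀ : ℕ → EI
    c₀ = upd _<_ sto (λ _ → unsetItv) 0 (emb _<_ sto J)

    r₀ : ℕ → List Iv
    r₀ = upd _<_ sto list 0 Js

    initial-scanning : Scanning c₀ r₀ 0 J
    initial-scanning = record
      { i≤n = z≤n
      ; cursors = record
          { first = refl
          ; firstCursor = cursor-start z≤n list₀≡
          ; cursorAt = λ _ _ → inj₁ (refl , refl)
          ; skipped = λ _ _ _ ()
          }
      ; separatedBelow = λ _ ()
      ; separatedAbove = λ { (suc _) _ _ (_ , ()) }
      ; separatedNext = λ _ ()
      }

    first-≤ : ∀ {J'} → MinimalSpan J' → lft J ≤ lft J'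
    first-≤ ((T , chain , refl) , _) with subst (T 0 ∈_) list₀≡ (proj₁ chain 0 z≤n)
    ... | here refl = ≤-refl
    ... | there T∈Js = inj₁ (All.lookup (AllPairs.head (subst (AllPairs StartsBefore) list₀≡
                                                        (antichain-sorted (list-antichain z≤n)))) T∈Js)

    enumerates-AND : Σ (List Iv) λ outs →
      Unique outs × (∀ J' → (J' ∈ outs → InAND _<_ As J') × (InAND _<_ As J' → J' ∈ outs)) ×
      Σ ℕ λ fuel → calls _<_ sto fuel (suc n) (suc (length outs)) (st c₀ r₀ 1)
                     ≡ just (map (emb _<_ sto) outs ++ (nullI _<_ sto ∷ []))
    enumerates-AND
      with calls-correct (4 + 3 * totalUnread r₀) (totalUnread r₀) (st c₀ r₀ 1) (active J) initial-scanning
                         ℕₚ.≤-refl ℕₚ.≤-refl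
    ... | outs , unique , members , calls≡ =
      outs , unique ,
      (λ J' → minimalSpan⇒inAND ∘ proj₁ ∘ proj₁ (members J') ,
              λ inAND → let minimal = inAND⇒minimalSpan inAND in proj₂ (members J') (minimal , first-≤ minimal)) ,
      4 + 3 * totalUnread r₀ , calls≡

mainTheorem9 : {A : Set} (_<_ : Rel A 0ℓ) (sto : IsStrictTotalOrder _≡_ _<_) →
    Finite A →
    (n : ℕ) (As : Vec (List (Itv _<_)) (suc n)) →
    (∀ k → NaturalAntichain _<_ (lookup As k)) →
    Σ (List (Itv _<_)) λ outs →
      Unique outs ×
      (∀ J → (J ∈ outs → InAND _<_ As J) × (InAND _<_ As J → J ∈ outs)) ×
      Σ ℕ λ fuel →
        calls _<_ sto fuel (suc n) (suc (length outs)) (initSt _<_ sto As)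
          ≡ just (map (emb _<_ sto) outs ++ (nullI _<_ sto ∷ []))
mainTheorem9 _<_ sto _ n ([] ∷ _) antichains = ⊥-elim (antichains fzero)
mainTheorem9 _<_ sto _ n As@((_ ∷ _) ∷ _) antichains = Correctness.Start.enumerates-AND _<_ sto n As antichains refl
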